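{- Let $m,n\ge0$ with $2m+n\ge1$, and let $(C,\overline C)$ be a partition of the vertex set of $D(m,n)$ into two nonempty sets. (a) $(C,\overline C)$ is an equitable partition with quotient matrix $\begin{pmatrix}0 & 6m+3n\\ 2m+n & 4m+2n\end{pmatrix}$ if and only if $C$ is an MDS code; and $(C,\overline C)$ is an equitable partition with quotient matrix $\begin{pmatrix}4m+2n & 2m+n\\ 6m+3n & 0\end{pmatrix}$ if and only if $\overline C$ is an MDS code. (b) $(C,\overline C)$ is an equitable partition with quotient matrix $\begin{pmatrix}2m+n & 4m+2n\\ 4m+2n & 2m+n\end{pmatrix}$ if and only if $C$ is a $2\times$MDS code.
   Context: The Shrikhande graph $\mathrm{Sh}$ is the Cayley graph of $\mathbb{Z}_4^2$ with connecting set $\{(0,1),(1,0),(1,1),(0,3),(3,0),(3,3)\}$. $K=K_4$ is the complete graph on $4$ vertices (Cayley graph of $\mathbb{Z}_2^2$ with connecting set $\{(0,1),(1,0),(1,1)\}$). $D(m,n)=\mathrm{Sh}^m\times K^n$ is the Cartesian product: vertices are tuples $(x_1,\dots,x_m,y_1,\dots,y_n)$, $x_i\in\mathbb{Z}_4^2$, $y_j\in\mathbb{Z}_2^2$, adjacent iff they differ in exactly one coordinate and the differing entries are adjacent in the corresponding factor. An MDS code in $D(m,n)$ is an independent set of vertices of cardinality $4^{2m+n-1}$. A Shrikhande line is the set of $16$ vertices obtained by fixing all coordinates except one $x_i$; a $K$-line is the set of $4$ vertices obtained by fixing all coordinates except one $y_j$. A $2\times$MDS code in $D(m,n)$ is a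 vertex set $M$ such that the intersection of $M$ with every Shrikhande line consists of $8$ vertices forming (in the copy of $\mathrm{Sh}$ induced by the line) the union of two disjoint independent $4$-sets, and every $K$-line contains exactly $2$ elements of $M$. A partition $(P_1,P_2)$ of the vertex set of a graph into nonempty cells is equitable with quotient matrix $(s_{ij})_{i,j=1}^2$ if for all $i,j$ every vertex of $P_i$ has exactly $s_{ij}$ neighbours in $P_j$. -}

module Defs where

open import Data.Bool using (Bool; true; false; _∧_; _∨_; not; if_then_else_)
open import Data.Nat using (ℕ; zero; suc; _+_; _∸_; _^_)
open import Data.Nat.DivMod using (_mod_)
open import Data.Fin using (Fin; toℕ; zero; suc)
open import Data.Fin.Properties using () renaming (_≟_ to _≟F_)
open import Data.Product using (Σ; _×_; _,_; proj₁; proj₂)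
open import Data.Product.Properties using (≡-dec)
open import Data.Vec using (Vec; []; _∷_; _[_]≔_)
import Data.Vec.Properties as VP
open import Data.List using (List; []; _∷_; map; concatMap; filter; length)
open import Relation.Nullary.Decidable using (⌊_⌋)
open import Relation.Binary.PropositionalEquality using (_≡_)

-- The factors.  Z4² = Fin 4 × Fin 4 (vertices of Sh), Z2² = Fin 2 × Fin 2 (vertices of K).

Z4² : Set
Z4² = Fin 4 × Fin 4

Z2² : Set
Z2² = Fin 2 × Fin 2

sub4 : Fin 4 → Fin 4 → Fin 4
sub4 a b = (toℕ a + (4 ∸ toℕ b)) mod 4

sub2 : Fin 2 → Fin 2 → Fin 2
sub2 a b = (toℕ a + (2 ∸ toℕ b)) mod 2

-- membership in the connecting set {(0,1),(1,0),(1,1),(0,3),(3,0),(3,3)} of Sh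
inShSet : ℕ → ℕ → Bool
inShSet 0 1 = true
inShSet 1 0 = true
inShSet 1 1 = true
inShSet 0 3 = true
inShSet 3 0 = true
inShSet 3 3 = true
inShSet _ _ = false

inKSet : ℕ → ℕ → Bool
inKSet 0 1 = true
inKSet 1 0 = true
inKSet 1 1 = true
inKSet _ _ = false

-- Cayley graph adjacency: u ~ v iff u - v is in the connecting set
shAdj : Z4² → Z4² → Bool
shAdj (a₁ , a₂) (b₁ , b₂) = inShSet (toℕ (sub4 a₁ b₁)) (toℕ (sub4 a₂ b₂))

kAdj : Z2² → Z2² → Bool
kAdj (a₁ , a₂) (b₁ , b₂) = inKSet (toℕ (sub2 a₁ b₁)) (toℕ (sub2 a₂ b₂))

eq4 : Z4² → Z4² → Bool
eq4 u v = ⌊ ≡-dec _≟F_ _≟F_ u v ⌋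

eq2 : Z2² → Z2² → Bool
eq2 u v = ⌊ ≡-dec _≟F_ _≟F_ u v ⌋

-- Cartesian powers: two tuples are adjacent iff they differ in exactly
-- one coordinate and the differing entries are adjacent in the factor.

vecEq : {A : Set} → (A → A → Bool) → {k : ℕ} → Vec A k → Vec A k → Bool
vecEq eq [] [] = true
vecEq eq (x ∷ xs) (y ∷ ys) = eq x y ∧ vecEq eq xs ys

vecAdj : {A : Set} → (A → A → Bool) → (A → A → Bool) → {k : ℕ} → Vec A k → Vec A k → Bool
vecAdj eq adj [] [] = false
vecAdj eq adj (x ∷ xs) (y ∷ ys) =
  (adj x y ∧ vecEq eq xs ys) ∨ (eq x y ∧ vecAdj eq adj xs ys)

-- Vertices of D(m,n) = Sh^m × K^n
Vertex : ℕ → ℕ → Set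
Vertex m n = Vec Z4² m × Vec Z2² n

adj : {m n : ℕ} → Vertex m n → Vertex m n → Bool
adj (x , y) (x' , y') =
  (vecAdj eq4 shAdj x x' ∧ vecEq eq2 y y') ∨ (vecEq eq4 x x' ∧ vecAdj eq2 kAdj y y')

allFin4 : List (Fin 4)
allFin4 = zero ∷ suc zero ∷ suc (suc zero) ∷ suc (suc (suc zero)) ∷ []

allFin2 : List (Fin 2)
allFin2 = zero ∷ suc zero ∷ []

pairs : {A B : Set} → List A → List B → List (A × B)
pairs as bs = concatMap (λ a → map (λ b → (a , b)) bs) as

allZ4² : List Z4²
allZ4² = pairs allFin4 allFin4

allZ2² : List Z2²
allZ2² = pairs allFin2 allFin2

allVec : {A : Set} → List A → (k : ℕ) → List (Vec A k)
allVec as zero = [] ∷ []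
allVec as (suc k) = concatMap (λ a → map (a ∷_) (allVec as k)) as

allVertices : (m n : ℕ) → List (Vertex m n)
allVertices m n = pairs (allVec allZ4² m) (allVec allZ2² n)

countL : {A : Set} → (A → Bool) → List A → ℕ
countL P [] = 0
countL P (x ∷ xs) = if P x then suc (countL P xs) else countL P xs

VSet : ℕ → ℕ → Set
VSet m n = Vertex m n → Bool

complement : {m n : ℕ} → VSet m n → VSet m n
complement C v = not (C v)

Nonempty : {m n : ℕ} → VSet m n → Set
Nonempty C = Σ _ λ v → C v ≡ true

card : {m n : ℕ} → VSet m n → ℕ
card {m} {n} C = countL C (allVertices m n)

nbrsIn : {m n : ℕ} → VSet m n → Vertex m n → ℕ
nbrsIn {m} {n} P v = countL (λ u → adj v u ∧ P u) (allVertices m n)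

-- (P₁ , P₂) is an equitable partition with quotient matrix ((s11 s12) (s21 s22))
-- (P₁ , P₂ assumed to be a partition with nonempty cells)
IsEquitable : {m n : ℕ} → VSet m n → VSet m n → ℕ → ℕ → ℕ → ℕ → Set
IsEquitable P₁ P₂ s11 s12 s21 s22 =
  (∀ v → P₁ v ≡ true → nbrsIn P₁ v ≡ s11 × nbrsIn P₂ v ≡ s12) ×
  (∀ v → P₂ v ≡ true → nbrsIn P₁ v ≡ s21 × nbrsIn P₂ v ≡ s22)

Independent : {m n : ℕ} → VSet m n → Set
Independent C = ∀ u v → C u ≡ true → C v ≡ true → adj u v ≡ false

IsMDS : {m n : ℕ} → VSet m n → Set
IsMDS {m} {n} C = Independent C × card C ≡ 4 ^ ((m + m + n) ∸ 1)

shLine : {m n : ℕ} → VSet m n → Vertex m n → Fin m → Z4² → Bool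
shLine C (x , y) i a = C (x [ i ]≔ a , y)

kLine : {m n : ℕ} → VSet m n → Vertex m n → Fin n → Z2² → Bool
kLine C (x , y) j b = C (x , y [ j ]≔ b)

cardSh : (Z4² → Bool) → ℕ
cardSh S = countL S allZ4²

cardK : (Z2² → Bool) → ℕ
cardK S = countL S allZ2²

IndependentSh : (Z4² → Bool) → Set
IndependentSh S = ∀ a b → S a ≡ true → S b ≡ true → shAdj a b ≡ false

UnionTwoIndep4 : (Z4² → Bool) → Set
UnionTwoIndep4 S =
  cardSh S ≡ 8 ×
  Σ (Z4² → Bool) λ A → Σ (Z4² → Bool) λ B →
    cardSh A ≡ 4 × cardSh B ≡ 4 × IndependentSh A × IndependentSh B ×
    (∀ a → A a ∧ B a ≡ false) × (∀ a → S a ≡ A a ∨ B a)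

Is2xMDS : {m n : ℕ} → VSet m n → Set
Is2xMDS {m} {n} C =
  (∀ (v : Vertex m n) (i : Fin m) → UnionTwoIndep4 (shLine C v i)) ×
  (∀ (v : Vertex m n) (j : Fin n) → cardK (kLine C v j) ≡ 2)

module Submission where

open import Defs
open import Data.Bool using (Bool; true; false; _∧_; _∨_; not; _xor_; if_then_else_)
open import Data.Bool.Properties using (∧-identityʳ; ∧-zeroʳ; ∨-identityʳ; not-involutive)
import Data.Bool.Properties as Bool
open import Data.Bool.ListAction using (any)
open import Data.Nat using (ℕ; zero; suc; _+_; _*_; _∸_; _^_; _≤_; _≤?_; z≤n; >-nonZero)
import Data.Nat as ℕ
open import Data.Nat.Properties
open import Algebra.Properties.CommutativeSemigroup +-commutativeSemigroup using (interchange)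
open import Data.Nat.Solver using (module +-*-Solver)
open +-*-Solver using (solve; _:+_; _:*_; con; _:=_)
open import Data.Fin using (Fin; zero; suc; #_)
import Data.Fin.Properties as Fin
open import Data.Vec using (Vec; []; _∷_; lookup; tabulate; _[_]≔_)
open import Data.Vec.Properties using ([]≔-idempotent; []≔-lookup; lookup∘tabulate; lookup∘update)
open import Data.List using (List; []; _∷_; _++_; map; concatMap; length; allFin)
open import Data.List.Properties using (map-tabulate; length-++; length-map; length-tabulate)
open import Data.List.Membership.Propositional using (_∈_; find)
open import Data.List.Membership.Propositional.Properties using (∈-map⁺; ∈-concatMap⁺; ∈-allFin)
open import Data.List.Relation.Unary.All using (All; all?)
import Data.List.Relation.Unary.All as All
open import Data.List.Relation.Unary.Any using (Any; here; there; any?)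
import Data.List.Relation.Unary.Any as Any
open import Data.Product using (Σ; _×_; _,_; proj₁; proj₂; swap)
open import Data.Product.Properties using (≡-dec)
open import Function.Bundles using (_⇔_; mk⇔; Equivalence)
open import Relation.Binary.Definitions using (DecidableEquality)
open import Relation.Binary.PropositionalEquality
open import Relation.Nullary using (Dec; yes; no; contradiction; _×-dec_; _→-dec_)
open import Relation.Nullary.Decidable using (⌊_⌋; from-yes)

-- A neighbourhood in D(m,n) splits along the coordinates: the neighbours of v are its neighbours
-- inside the m Shrikhande lines and the n K-lines through v, and summing over all vertices and the
-- points of their lines in one direction counts every vertex 16 (resp. 4) times.
-- (a) The edges between C and its complement give |C|(6m+3n) = |C̄|(2m+n), hence |C| = 4^(2m+n-1).
-- Conversely, an independent set of that size meets every Shrikhande line in an independent 4-set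
-- and every K-line in one vertex, and an outside vertex then has 2 resp. 1 neighbours in C on each line.
-- (b) If every vertex has 4m+2n neighbours in the other cell, the cuts of all lines add up to the
-- maximum allowed by the line-wise bounds (64 in Sh, 8 in K), so every line is cut maximally; in Sh
-- this forces a union of two disjoint independent 4-sets, in K two vertices.  Conversely such lines
-- give the required neighbour counts.  The facts about Sh and K are checked on all their subsets.

∑ : {A : Set} → List A → (A → ℕ) → ℕ
∑ []       f = 0
∑ (x ∷ xs) f = f x + ∑ xs f

infix 5 ∑
syntax ∑ xs (λ x → e) = ∑[ x ∈ xs ] e

infixl 7 _·_

_·_ : Bool → ℕ → ℕ
true  · n = n
false · n = 0

private
  variable
    A B C : Set


∑-cong : (xs : List A) {f g : A → ℕ} → (∀ x → f x ≡ g x) → ∑ xs f ≡ ∑ xs g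
∑-cong []       f≗g = refl
∑-cong (x ∷ xs) f≗g = cong₂ _+_ (f≗g x) (∑-cong xs f≗g)

∑-+ : (xs : List A) (f g : A → ℕ) → ∑[ x ∈ xs ] (f x + g x) ≡ ∑ xs f + ∑ xs g
∑-+ []       f g = refl
∑-+ (x ∷ xs) f g = trans (cong (f x + g x +_) (∑-+ xs f g)) (interchange (f x) (g x) (∑ xs f) (∑ xs g))

∑-*ˡ : (xs : List A) (c : ℕ) (f : A → ℕ) → ∑[ x ∈ xs ] c * f x ≡ c * ∑ xs f
∑-*ˡ []       c f = sym (*-zeroʳ c)
∑-*ˡ (x ∷ xs) c f = trans (cong (c * f x +_) (∑-*ˡ xs c f)) (sym (*-distribˡ-+ c (f x) (∑ xs f)))

∑-·ˡ : (xs : List A) (b : Bool) (f : A → ℕ) → ∑[ x ∈ xs ] b · f x ≡ b · ∑ xs f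
∑-·ˡ xs       true  f = refl
∑-·ˡ []       false f = refl
∑-·ˡ (x ∷ xs) false f = ∑-·ˡ xs false f

∑-const : (xs : List A) (c : ℕ) → ∑[ x ∈ xs ] c ≡ length xs * c
∑-const []       c = refl
∑-const (x ∷ xs) c = cong (c +_) (∑-const xs c)

∑-zero : (xs : List A) → ∑[ x ∈ xs ] 0 ≡ 0
∑-zero xs = trans (∑-const xs 0) (*-zeroʳ (length xs))

∑-swap : (xs : List A) (ys : List B) (f : A → B → ℕ) →
         ∑[ x ∈ xs ] ∑[ y ∈ ys ] f x y ≡ ∑[ y ∈ ys ] ∑[ x ∈ xs ] f x y
∑-swap []       ys f = sym (∑-zero ys)
∑-swap (x ∷ xs) ys f =
  trans (cong (∑ ys (f x) +_) (∑-swap xs ys f)) (sym (∑-+ ys (f x) (λ y → ∑[ x ∈ xs ] f x y)))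

∑-++ : (xs ys : List A) (f : A → ℕ) → ∑ (xs ++ ys) f ≡ ∑ xs f + ∑ ys f
∑-++ []       ys f = refl
∑-++ (x ∷ xs) ys f = trans (cong (f x +_) (∑-++ xs ys f)) (sym (+-assoc (f x) (∑ xs f) (∑ ys f)))

∑-map : (g : A → B) (xs : List A) (f : B → ℕ) → ∑ (map g xs) f ≡ ∑[ x ∈ xs ] f (g x)
∑-map g []       f = refl
∑-map g (x ∷ xs) f = cong (f (g x) +_) (∑-map g xs f)

∑-product : (g : A → B → C) (xs : List A) (ys : List B) (f : C → ℕ) →
            ∑ (concatMap (λ x → map (g x) ys) xs) f ≡ ∑[ x ∈ xs ] ∑[ y ∈ ys ] f (g x y)
∑-product g []       ys f = refl
∑-product g (x ∷ xs) ys f =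
  trans (∑-++ (map (g x) ys) _ f) (cong₂ _+_ (∑-map (g x) ys f) (∑-product g xs ys f))

∑-mono : (xs : List A) {f g : A → ℕ} → (∀ x → f x ≤ g x) → ∑ xs f ≤ ∑ xs g
∑-mono []       f≤g = z≤n
∑-mono (x ∷ xs) f≤g = +-mono-≤ (f≤g x) (∑-mono xs f≤g)

∑-mono-tight : (xs : List A) {f g : A → ℕ} → (∀ x → f x ≤ g x) → ∑ xs g ≤ ∑ xs f →
               ∀ {x} → x ∈ xs → f x ≡ g x
∑-mono-tight (y ∷ ys) {f} {g} f≤g tight (here refl) =
  ≤-antisym (f≤g y) (+-cancelʳ-≤ (∑ ys f) (g y) (f y) (≤-trans (+-monoʳ-≤ (g y) (∑-mono ys f≤g)) tight))
∑-mono-tight (y ∷ ys) {f} {g} f≤g tight (there x∈ys) =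
  ∑-mono-tight ys f≤g (+-cancelˡ-≤ (f y) (∑ ys g) (∑ ys f) (≤-trans (+-monoˡ-≤ (∑ ys g) (f≤g y)) tight)) x∈ys

∑-All-zero : {xs : List A} {f : A → ℕ} → All (λ x → f x ≡ 0) xs → ∑ xs f ≡ 0
∑-All-zero All.[]              = refl
∑-All-zero (fx≡0 All.∷ fxs≡0) = cong₂ _+_ fx≡0 (∑-All-zero fxs≡0)

∑-·-count : (xs : List A) (P : A → Bool) (f : A → ℕ) (c : ℕ) →
            (∀ x → P x ≡ true → f x ≡ c) → ∑[ x ∈ xs ] P x · f x ≡ countL P xs * c
∑-·-count []       P f c on-P = refl
∑-·-count (x ∷ xs) P f c on-P with P x in Px
... | true  = cong₂ _+_ (on-P x Px) (∑-·-count xs P f c on-P)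
... | false = ∑-·-count xs P f c on-P

count-∑ : (P : A → Bool) (xs : List A) → countL P xs ≡ ∑[ x ∈ xs ] P x · 1
count-∑ P []       = refl
count-∑ P (x ∷ xs) with P x
... | true  = cong suc (count-∑ P xs)
... | false = count-∑ P xs

countL-cong : (xs : List A) {P Q : A → Bool} → (∀ x → P x ≡ Q x) → countL P xs ≡ countL Q xs
countL-cong xs P≗Q = trans (count-∑ _ xs) (trans (∑-cong xs (λ x → cong (_· 1) (P≗Q x))) (sym (count-∑ _ xs)))

countL-complement : (P : A → Bool) (xs : List A) → countL P xs + countL (λ x → not (P x)) xs ≡ length xs
countL-complement P []       = refl
countL-complement P (x ∷ xs) with P x
... | true  = cong suc (countL-complement P xs)
... | false = trans (+-suc _ _) (cong suc (countL-complement P xs))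

∑-allFin-suc : (k : ℕ) (f : Fin (suc k) → ℕ) →
               ∑[ i ∈ allFin (suc k) ] f i ≡ f zero + (∑[ i ∈ allFin k ] f (suc i))
∑-allFin-suc k f =
  cong (f zero +_) (trans (cong (λ is → ∑ is f) (sym (map-tabulate (λ i → i) suc))) (∑-map suc (allFin k) f))

∑-allFin-const : ∀ k c → ∑[ i ∈ allFin k ] c ≡ k * c
∑-allFin-const k c = trans (∑-const (allFin k) c) (cong (_* c) (length-tabulate {n = k} (λ i → i)))

∧-· : ∀ b c n → (b ∧ c) · n ≡ b · (c · n)
∧-· true  c n = refl
∧-· false c n = refl

∨-·-disjoint : ∀ a e q r n → (a ≡ true → q ≡ false) → ((a ∧ e) ∨ (q ∧ r)) · n ≡ a · (e · n) + q · (r · n)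
∨-·-disjoint true  true  q r n a⇒¬q rewrite a⇒¬q refl = sym (+-identityʳ n)
∨-·-disjoint true  false q r n a⇒¬q rewrite a⇒¬q refl = refl
∨-·-disjoint false e     q r n _    = ∧-· q r n

module _ (_≟_ : DecidableEquality A) where

  ∑-select : (as : List A) (a : A) (h : A → ℕ) → ∑[ b ∈ as ] ⌊ a ≟ b ⌋ · h b ≡ countL (λ b → ⌊ a ≟ b ⌋) as * h a
  ∑-select []       a h = refl
  ∑-select (b ∷ as) a h with a ≟ b
  ... | yes refl = cong (h a +_) (∑-select as a h)
  ... | no _     = ∑-select as a h

  Selecting : List A → Set
  Selecting U = ∀ a (h : A → ℕ) → ∑[ b ∈ U ] ⌊ a ≟ b ⌋ · h b ≡ h a

  selecting : (U : List A) → (∀ a → countL (λ b → ⌊ a ≟ b ⌋) U ≡ 1) → Selecting U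
  selecting U once a h = trans (∑-select U a h) (trans (cong (_* h a) (once a)) (*-identityˡ (h a)))

  ∑-multiplicity : (U : List A) → Selecting U →
                   (ps : List A) (f : A → ℕ) → ∑ ps f ≡ ∑[ u ∈ U ] countL (λ p → ⌊ p ≟ u ⌋) ps * f u
  ∑-multiplicity U select []       f = sym (∑-zero U)
  ∑-multiplicity U select (p ∷ ps) f = begin
    f p + ∑ ps f
      ≡⟨ cong₂ _+_ (sym (select p f)) (∑-multiplicity U select ps f) ⟩
    (∑[ u ∈ U ] ⌊ p ≟ u ⌋ · f u) + (∑[ u ∈ U ] countL (λ q → ⌊ q ≟ u ⌋) ps * f u)
      ≡⟨ ∑-+ U _ _ ⟨
    ∑[ u ∈ U ] (⌊ p ≟ u ⌋ · f u + countL (λ q → ⌊ q ≟ u ⌋) ps * f u)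
      ≡⟨ ∑-cong U step ⟩
    ∑[ u ∈ U ] countL (λ q → ⌊ q ≟ u ⌋) (p ∷ ps) * f u ∎
    where
    open ≡-Reasoning
    step : ∀ u → ⌊ p ≟ u ⌋ · f u + countL (λ q → ⌊ q ≟ u ⌋) ps * f u ≡ countL (λ q → ⌊ q ≟ u ⌋) (p ∷ ps) * f u
    step u with p ≟ u
    ... | yes _ = refl
    ... | no _  = refl

∈-product : (g : A → B → C) {xs : List A} {ys : List B} {x : A} {y : B} →
            x ∈ xs → y ∈ ys → g x y ∈ concatMap (λ x → map (g x) ys) xs
∈-product g {ys = ys} x∈xs y∈ys = ∈-concatMap⁺ (λ x → map (g x) ys) (Any.map (λ { refl → ∈-map⁺ (g _) y∈ys }) x∈xs)

∈-allVec : {as : List A} → (∀ a → a ∈ as) → ∀ {k} (xs : Vec A k) → xs ∈ allVec as k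
∈-allVec complete []       = here refl
∈-allVec complete (x ∷ xs) = ∈-product _∷_ (complete x) (∈-allVec complete xs)

byExhaustion : {as : List A} {P : A → Set} → (∀ a → a ∈ as) → All P as → ∀ a → P a
byExhaustion complete all-P a = All.lookup all-P (complete a)

length-product : (g : A → B → C) (xs : List A) (ys : List B) →
                 length (concatMap (λ x → map (g x) ys) xs) ≡ length xs * length ys
length-product g []       ys = refl
length-product g (x ∷ xs) ys =
  trans (length-++ (map (g x) ys)) (cong₂ _+_ (length-map (g x) ys) (length-product g xs ys))

length-allVec : (as : List A) (k : ℕ) → length (allVec as k) ≡ length as ^ k
length-allVec as zero    = refl
length-allVec as (suc k) =
  trans (length-product _∷_ as (allVec as k)) (cong (length as *_) (length-allVec as k))

∑-update : (as : List A) {k : ℕ} (i : Fin k) (g : Vec A k → ℕ) →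
           ∑[ xs ∈ allVec as k ] ∑[ a ∈ as ] g (xs [ i ]≔ a) ≡ length as * ∑ (allVec as k) g
∑-update as {suc k} zero g = begin
  ∑[ xs ∈ allVec as (suc k) ] ∑[ a ∈ as ] g (xs [ zero ]≔ a)   ≡⟨ ∑-product _∷_ as (allVec as k) _ ⟩
  ∑[ x ∈ as ] ∑[ xs ∈ allVec as k ] ∑[ a ∈ as ] g (a ∷ xs)     ≡⟨ ∑-const as _ ⟩
  length as * (∑[ xs ∈ allVec as k ] ∑[ a ∈ as ] g (a ∷ xs))   ≡⟨ cong (length as *_) (∑-swap (allVec as k) as _) ⟩
  length as * (∑[ a ∈ as ] ∑[ xs ∈ allVec as k ] g (a ∷ xs))   ≡⟨ cong (length as *_) (∑-product _∷_ as (allVec as k) g) ⟨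
  length as * ∑ (allVec as (suc k)) g                          ∎
  where open ≡-Reasoning
∑-update as {suc k} (suc i) g = begin
  ∑[ xs ∈ allVec as (suc k) ] ∑[ a ∈ as ] g (xs [ suc i ]≔ a)   ≡⟨ ∑-product _∷_ as (allVec as k) _ ⟩
  ∑[ x ∈ as ] ∑[ xs ∈ allVec as k ] ∑[ a ∈ as ] g (x ∷ xs [ i ]≔ a)
    ≡⟨ ∑-cong as (λ x → ∑-update as i (λ xs → g (x ∷ xs))) ⟩
  ∑[ x ∈ as ] length as * (∑[ xs ∈ allVec as k ] g (x ∷ xs))    ≡⟨ ∑-*ˡ as (length as) _ ⟩
  length as * (∑[ x ∈ as ] ∑[ xs ∈ allVec as k ] g (x ∷ xs))    ≡⟨ cong (length as *_) (∑-product _∷_ as (allVec as k) g) ⟨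
  length as * ∑ (allVec as (suc k)) g                           ∎
  where open ≡-Reasoning

nbrsAmong : (A → A → Bool) → List A → (A → Bool) → A → ℕ
nbrsAmong adj as S a = ∑[ b ∈ as ] adj a b · (S b · 1)

countL-nbrsAmong : (adj : A → A → Bool) (as : List A) (S : A → Bool) (a : A) →
                   countL (λ b → adj a b ∧ S b) as ≡ nbrsAmong adj as S a
countL-nbrsAmong adj as S a = trans (count-∑ _ as) (∑-cong as (λ b → ∧-· (adj a b) (S b) 1))

module _ (adj : A → A → Bool) (as : List A) where

  nbrsAmong-cong : ∀ {S S'} a → (∀ b → S b ≡ S' b) → nbrsAmong adj as S a ≡ nbrsAmong adj as S' a
  nbrsAmong-cong a S≗S' = ∑-cong as (λ b → cong (λ s → adj a b · (s · 1)) (S≗S' b))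

  nbrsAmong-∨ : ∀ (S S' : A → Bool) a → (∀ b → S b ∧ S' b ≡ false) →
                nbrsAmong adj as (λ b → S b ∨ S' b) a ≡ nbrsAmong adj as S a + nbrsAmong adj as S' a
  nbrsAmong-∨ S S' a disjoint = trans (∑-cong as (λ b → split (adj a b) (S b) (S' b) (disjoint b))) (∑-+ as _ _)
    where
    split : ∀ e s s' → s ∧ s' ≡ false → e · ((s ∨ s') · 1) ≡ e · (s · 1) + e · (s' · 1)
    split false s     s'    _ = refl
    split true  true  false _ = refl
    split true  false s'    _ = refl

  nbrsAmong-complement : ∀ (S : A → Bool) a →
                         nbrsAmong adj as S a + nbrsAmong adj as (λ b → not (S b)) a ≡ nbrsAmong adj as (λ _ → true) a
  nbrsAmong-complement S a =
    trans (sym (nbrsAmong-∨ S (λ b → not (S b)) a (λ b → Bool.∧-inverseʳ (S b))))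
          (nbrsAmong-cong a (λ b → Bool.∨-inverseʳ (S b)))

  nbrsAmong-none : ∀ (S : A → Bool) a → (∀ b → S b ≡ true → adj a b ≡ false) → nbrsAmong adj as S a ≡ 0
  nbrsAmong-none S a no-nbr = trans (∑-cong as no-edge) (∑-zero as)
    where
    no-edge : ∀ b → adj a b · (S b · 1) ≡ 0
    no-edge b with S b in Sb
    ... | true  rewrite no-nbr b Sb = refl
    ... | false with adj a b
    ...   | true  = refl
    ...   | false = refl

  nbrsAmong-none⁻ : ∀ (S : A → Bool) a → nbrsAmong adj as S a ≡ 0 → ∀ {b} → b ∈ as → S b ≡ true → adj a b ≡ false
  nbrsAmong-none⁻ S a none {b} b∈as Sb = lemma (adj a b) (sym term≡0)
    where
    term≡0 : 0 ≡ adj a b · (S b · 1)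
    term≡0 = ∑-mono-tight as {λ _ → 0} (λ _ → z≤n) (≤-reflexive (trans none (sym (∑-zero as)))) b∈as
    lemma : ∀ e → e · (S b · 1) ≡ 0 → e ≡ false
    lemma false _ = refl
    lemma true  e≡0 = contradiction (trans (sym (cong (_· 1) Sb)) e≡0) λ ()

double-counting : (adj : A → A → Bool) → (∀ a b → adj a b ≡ adj b a) → (as : List A) (P Q : A → Bool) →
                  ∑[ a ∈ as ] P a · nbrsAmong adj as Q a ≡ ∑[ a ∈ as ] Q a · nbrsAmong adj as P a
double-counting adj adj-sym as P Q = begin
  ∑[ a ∈ as ] P a · nbrsAmong adj as Q a             ≡⟨ ∑-cong as (λ a → sym (∑-·ˡ as (P a) _)) ⟩
  ∑[ a ∈ as ] ∑[ b ∈ as ] P a · (adj a b · (Q b · 1)) ≡⟨ ∑-swap as as _ ⟩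
  ∑[ b ∈ as ] ∑[ a ∈ as ] P a · (adj a b · (Q b · 1))
    ≡⟨ ∑-cong as (λ b → ∑-cong as (λ a → trans (cong (λ e → P a · (e · (Q b · 1))) (adj-sym a b)) (·-exchange (P a) (adj b a) (Q b)))) ⟩
  ∑[ b ∈ as ] ∑[ a ∈ as ] Q b · (adj b a · (P a · 1)) ≡⟨ ∑-cong as (λ b → ∑-·ˡ as (Q b) _) ⟩
  ∑[ b ∈ as ] Q b · nbrsAmong adj as P b             ∎
  where
  open ≡-Reasoning
  ·-exchange : ∀ p e q → p · (e · (q · 1)) ≡ q · (e · (p · 1))
  ·-exchange true  e     true  = refl
  ·-exchange true  true  false = refl
  ·-exchange true  false false = refl
  ·-exchange false true  true  = refl
  ·-exchange false false true  = refl
  ·-exchange false e     false = refl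

-- Cartesian powers of a graph

≟-sym : (_≟_ : DecidableEquality A) (a b : A) → ⌊ a ≟ b ⌋ ≡ ⌊ b ≟ a ⌋
≟-sym _≟_ a b with a ≟ b | b ≟ a
... | yes _    | yes _    = refl
... | no _     | no _     = refl
... | yes refl | no b≢a   = contradiction refl b≢a
... | no a≢b   | yes refl = contradiction refl a≢b

module CartesianPower (_≟_ : DecidableEquality A) (as : List A) (select : Selecting _≟_ as)
  (adj : A → A → Bool) (adj-irrefl : ∀ a → adj a a ≡ false) (adj-sym : ∀ a b → adj a b ≡ adj b a) where

  private
    eq : A → A → Bool
    eq a b = ⌊ a ≟ b ⌋

    eq-refl : ∀ a → eq a a ≡ true
    eq-refl a with a ≟ a
    ... | yes _  = refl
    ... | no a≢a = contradiction refl a≢a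

    adj⇒¬eq : ∀ a b → adj a b ≡ true → eq a b ≡ false
    adj⇒¬eq a b ab with a ≟ b
    ... | yes refl = contradiction (trans (sym ab) (adj-irrefl a)) λ ()
    ... | no _     = refl

  vecEq-refl : ∀ {k} (xs : Vec A k) → vecEq eq xs xs ≡ true
  vecEq-refl []       = refl
  vecEq-refl (x ∷ xs) rewrite eq-refl x = vecEq-refl xs

  vecAdj-irrefl : ∀ {k} (xs : Vec A k) → vecAdj eq adj xs xs ≡ false
  vecAdj-irrefl []       = refl
  vecAdj-irrefl (x ∷ xs) rewrite adj-irrefl x | eq-refl x = vecAdj-irrefl xs

  vecEq-sym : ∀ {k} (xs ys : Vec A k) → vecEq eq xs ys ≡ vecEq eq ys xs
  vecEq-sym []       []       = refl
  vecEq-sym (x ∷ xs) (y ∷ ys) = cong₂ _∧_ (≟-sym _≟_ x y) (vecEq-sym xs ys)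

  vecAdj-sym : ∀ {k} (xs ys : Vec A k) → vecAdj eq adj xs ys ≡ vecAdj eq adj ys xs
  vecAdj-sym []       []       = refl
  vecAdj-sym (x ∷ xs) (y ∷ ys) =
    cong₂ _∨_ (cong₂ _∧_ (adj-sym x y) (vecEq-sym xs ys)) (cong₂ _∧_ (≟-sym _≟_ x y) (vecAdj-sym xs ys))

  vecAdj-update : ∀ {k} (xs : Vec A k) i a b → vecAdj eq adj (xs [ i ]≔ a) (xs [ i ]≔ b) ≡ adj a b
  vecAdj-update (x ∷ xs) zero    a b
    rewrite vecEq-refl xs | vecAdj-irrefl xs | ∧-identityʳ (adj a b) | ∧-zeroʳ (eq a b) = ∨-identityʳ (adj a b)
  vecAdj-update (x ∷ xs) (suc i) a b rewrite adj-irrefl x | eq-refl x = vecAdj-update xs i a b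

  vecAdj⇒¬vecEq : ∀ {k} (xs ys : Vec A k) → vecAdj eq adj xs ys ≡ true → vecEq eq xs ys ≡ false
  vecAdj⇒¬vecEq []       []       ()
  vecAdj⇒¬vecEq (x ∷ xs) (y ∷ ys) xy with adj x y in xy-adj
  ... | true  rewrite adj⇒¬eq x y xy-adj = refl
  ... | false with eq x y
  ...   | true  = vecAdj⇒¬vecEq xs ys xy
  ...   | false = refl

  vecEq-select : ∀ {k} (xs : Vec A k) (h : Vec A k → ℕ) → ∑[ ys ∈ allVec as k ] vecEq eq xs ys · h ys ≡ h xs
  vecEq-select []               h = +-identityʳ (h [])
  vecEq-select {suc k} (x ∷ xs) h = begin
    ∑[ ys ∈ allVec as (suc k) ] vecEq eq (x ∷ xs) ys · h ys
      ≡⟨ ∑-product _∷_ as (allVec as k) _ ⟩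
    ∑[ b ∈ as ] ∑[ ys ∈ allVec as k ] (eq x b ∧ vecEq eq xs ys) · h (b ∷ ys)
      ≡⟨ ∑-cong as (λ b → trans (∑-cong (allVec as k) (λ ys → ∧-· (eq x b) _ _)) (∑-·ˡ (allVec as k) (eq x b) _)) ⟩
    ∑[ b ∈ as ] eq x b · (∑[ ys ∈ allVec as k ] vecEq eq xs ys · h (b ∷ ys))
      ≡⟨ ∑-cong as (λ b → cong (eq x b ·_) (vecEq-select xs (λ ys → h (b ∷ ys)))) ⟩
    ∑[ b ∈ as ] eq x b · h (b ∷ xs)
      ≡⟨ select x (λ b → h (b ∷ xs)) ⟩
    h (x ∷ xs) ∎
    where open ≡-Reasoning

  vecAdj-lines : ∀ {k} (xs : Vec A k) (h : Vec A k → ℕ) →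
                 ∑[ ys ∈ allVec as k ] vecAdj eq adj xs ys · h ys ≡
                 ∑[ i ∈ allFin k ] ∑[ a ∈ as ] adj (lookup xs i) a · h (xs [ i ]≔ a)
  vecAdj-lines []               h = refl
  vecAdj-lines {suc k} (x ∷ xs) h = begin
    ∑[ ys ∈ allVec as (suc k) ] vecAdj eq adj (x ∷ xs) ys · h ys
      ≡⟨ ∑-product _∷_ as (allVec as k) _ ⟩
    ∑[ b ∈ as ] ∑[ ys ∈ allVec as k ] ((adj x b ∧ vecEq eq xs ys) ∨ (eq x b ∧ vecAdj eq adj xs ys)) · h (b ∷ ys)
      ≡⟨ ∑-cong as (λ b → trans (∑-cong (allVec as k) (λ ys → ∨-·-disjoint (adj x b) _ (eq x b) _ _ (adj⇒¬eq x b)))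
                                (∑-+ (allVec as k) _ _)) ⟩
    ∑[ b ∈ as ] ((∑[ ys ∈ allVec as k ] adj x b · (vecEq eq xs ys · h (b ∷ ys)))
                 + (∑[ ys ∈ allVec as k ] eq x b · (vecAdj eq adj xs ys · h (b ∷ ys))))
      ≡⟨ ∑-+ as _ _ ⟩
    (∑[ b ∈ as ] ∑[ ys ∈ allVec as k ] adj x b · (vecEq eq xs ys · h (b ∷ ys)))
      + (∑[ b ∈ as ] ∑[ ys ∈ allVec as k ] eq x b · (vecAdj eq adj xs ys · h (b ∷ ys)))
      ≡⟨ cong₂ _+_ (∑-cong as λ b → trans (∑-·ˡ (allVec as k) (adj x b) _) (cong (adj x b ·_) (vecEq-select xs (λ ys → h (b ∷ ys)))))
                   (trans (∑-cong as λ b → ∑-·ˡ (allVec as k) (eq x b) _) (select x _)) ⟩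
    (∑[ b ∈ as ] adj x b · h (b ∷ xs)) + (∑[ ys ∈ allVec as k ] vecAdj eq adj xs ys · h (x ∷ ys))
      ≡⟨ cong ((∑[ b ∈ as ] adj x b · h (b ∷ xs)) +_) (vecAdj-lines xs (λ ys → h (x ∷ ys))) ⟩
    (∑[ b ∈ as ] adj x b · h (b ∷ xs)) + (∑[ i ∈ allFin k ] ∑[ a ∈ as ] adj (lookup xs i) a · h (x ∷ xs [ i ]≔ a))
      ≡⟨ ∑-allFin-suc k (λ i → ∑[ a ∈ as ] adj (lookup (x ∷ xs) i) a · h ((x ∷ xs) [ i ]≔ a)) ⟨
    ∑[ i ∈ allFin (suc k) ] ∑[ a ∈ as ] adj (lookup (x ∷ xs) i) a · h ((x ∷ xs) [ i ]≔ a) ∎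
    where open ≡-Reasoning

∈-allFin4 : ∀ i → i ∈ allFin4
∈-allFin4 zero                   = here refl
∈-allFin4 (suc zero)             = there (here refl)
∈-allFin4 (suc (suc zero))       = there (there (here refl))
∈-allFin4 (suc (suc (suc zero))) = there (there (there (here refl)))

∈-allFin2 : ∀ i → i ∈ allFin2
∈-allFin2 zero       = here refl
∈-allFin2 (suc zero) = there (here refl)

∈-allZ4² : ∀ a → a ∈ allZ4²
∈-allZ4² (i , j) = ∈-product _,_ (∈-allFin4 i) (∈-allFin4 j)

∈-allZ2² : ∀ c → c ∈ allZ2²
∈-allZ2² (i , j) = ∈-product _,_ (∈-allFin2 i) (∈-allFin2 j)

∈-pairs : {as : List A} {bs : List B} → (∀ a → a ∈ as) → (∀ b → b ∈ bs) → ∀ p → p ∈ pairs as bs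
∈-pairs complete₁ complete₂ (a , b) = ∈-product _,_ (complete₁ a) (complete₂ b)

∈-allVertices : ∀ {m n} (v : Vertex m n) → v ∈ allVertices m n
∈-allVertices = ∈-pairs (∈-allVec ∈-allZ4²) (∈-allVec ∈-allZ2²)

_≟₄_ : DecidableEquality Z4²
_≟₄_ = ≡-dec Fin._≟_ Fin._≟_

_≟₂_ : DecidableEquality Z2²
_≟₂_ = ≡-dec Fin._≟_ Fin._≟_

select4 : Selecting _≟₄_ allZ4²
select4 = selecting _≟₄_ allZ4²
  (byExhaustion ∈-allZ4² (from-yes (all? (λ a → countL (λ b → ⌊ a ≟₄ b ⌋) allZ4² ℕ.≟ 1) allZ4²)))

select2 : Selecting _≟₂_ allZ2²
select2 = selecting _≟₂_ allZ2²
  (byExhaustion ∈-allZ2² (from-yes (all? (λ c → countL (λ d → ⌊ c ≟₂ d ⌋) allZ2² ℕ.≟ 1) allZ2²)))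

shAdj-irrefl : ∀ a → shAdj a a ≡ false
shAdj-irrefl = byExhaustion ∈-allZ4² (from-yes (all? (λ a → shAdj a a Bool.≟ false) allZ4²))

kAdj-irrefl : ∀ c → kAdj c c ≡ false
kAdj-irrefl = byExhaustion ∈-allZ2² (from-yes (all? (λ c → kAdj c c Bool.≟ false) allZ2²))

shAdj-sym : ∀ a b → shAdj a b ≡ shAdj b a
shAdj-sym a b = byExhaustion (∈-pairs ∈-allZ4² ∈-allZ4²)
  (from-yes (all? (λ (a , b) → shAdj a b Bool.≟ shAdj b a) (pairs allZ4² allZ4²))) (a , b)

kAdj-sym : ∀ c d → kAdj c d ≡ kAdj d c
kAdj-sym c d = byExhaustion (∈-pairs ∈-allZ2² ∈-allZ2²)
  (from-yes (all? (λ (c , d) → kAdj c d Bool.≟ kAdj d c) (pairs allZ2² allZ2²))) (c , d)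

module Sh = CartesianPower _≟₄_ allZ4² select4 shAdj shAdj-irrefl shAdj-sym
module K  = CartesianPower _≟₂_ allZ2² select2 kAdj kAdj-irrefl kAdj-sym

nbrsInSh : (Z4² → Bool) → Z4² → ℕ
nbrsInSh = nbrsAmong shAdj allZ4²

nbrsInK : (Z2² → Bool) → Z2² → ℕ
nbrsInK = nbrsAmong kAdj allZ2²

IndependentK : (Z2² → Bool) → Set
IndependentK S = ∀ c d → S c ≡ true → S d ≡ true → kAdj c d ≡ false

shDegree : ∀ a → nbrsInSh (λ _ → true) a ≡ 6
shDegree = byExhaustion ∈-allZ4² (from-yes (all? (λ a → nbrsInSh (λ _ → true) a ℕ.≟ 6) allZ4²))

kDegree : ∀ c → nbrsInK (λ _ → true) c ≡ 3
kDegree = byExhaustion ∈-allZ2² (from-yes (all? (λ c → nbrsInK (λ _ → true) c ℕ.≟ 3) allZ2²))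

-- Lines of D(m,n)

nbrsIn-nbrsAmong : ∀ {m n} (P : VSet m n) v → nbrsIn P v ≡ nbrsAmong adj (allVertices m n) P v
nbrsIn-nbrsAmong {m} {n} P v = countL-nbrsAmong adj (allVertices m n) P v

adj-sym : ∀ {m n} (u v : Vertex m n) → adj u v ≡ adj v u
adj-sym (x , y) (x' , y') = cong₂ _∨_ (cong₂ _∧_ (Sh.vecAdj-sym x x') (K.vecEq-sym y y'))
                                      (cong₂ _∧_ (Sh.vecEq-sym x x') (K.vecAdj-sym y y'))

nbrsIn-lines : ∀ {m n} (P : VSet m n) (x : Vec Z4² m) (y : Vec Z2² n) →
               nbrsIn P (x , y) ≡ (∑[ i ∈ allFin m ] nbrsInSh (shLine P (x , y) i) (lookup x i))
                                 + (∑[ j ∈ allFin n ] nbrsInK (kLine P (x , y) j) (lookup y j))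
nbrsIn-lines {m} {n} P x y = begin
  nbrsIn P (x , y)
    ≡⟨ nbrsIn-nbrsAmong P (x , y) ⟩
  ∑[ v ∈ allVertices m n ] adj (x , y) v · (P v · 1)
    ≡⟨ ∑-product _,_ X Y _ ⟩
  ∑[ x' ∈ X ] ∑[ y' ∈ Y ] adj (x , y) (x' , y') · (P (x' , y') · 1)
    ≡⟨ ∑-cong X (λ x' → trans (∑-cong Y (λ y' → split x' y')) (∑-+ Y _ _)) ⟩
  ∑[ x' ∈ X ] ((∑[ y' ∈ Y ] vecAdj eq4 shAdj x x' · (vecEq eq2 y y' · (P (x' , y') · 1)))
               + (∑[ y' ∈ Y ] vecEq eq4 x x' · (vecAdj eq2 kAdj y y' · (P (x' , y') · 1))))
    ≡⟨ ∑-+ X _ _ ⟩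
  (∑[ x' ∈ X ] ∑[ y' ∈ Y ] vecAdj eq4 shAdj x x' · (vecEq eq2 y y' · (P (x' , y') · 1)))
    + (∑[ x' ∈ X ] ∑[ y' ∈ Y ] vecEq eq4 x x' · (vecAdj eq2 kAdj y y' · (P (x' , y') · 1)))
    ≡⟨ cong₂ _+_ sh-part k-part ⟩
  (∑[ i ∈ allFin m ] nbrsInSh (shLine P (x , y) i) (lookup x i))
    + (∑[ j ∈ allFin n ] nbrsInK (kLine P (x , y) j) (lookup y j)) ∎
  where
  open ≡-Reasoning
  X : List (Vec Z4² m)
  X = allVec allZ4² m
  Y : List (Vec Z2² n)
  Y = allVec allZ2² n

  split : ∀ x' y' → adj (x , y) (x' , y') · (P (x' , y') · 1) ≡
                    vecAdj eq4 shAdj x x' · (vecEq eq2 y y' · (P (x' , y') · 1))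
                    + vecEq eq4 x x' · (vecAdj eq2 kAdj y y' · (P (x' , y') · 1))
  split x' y' = ∨-·-disjoint (vecAdj eq4 shAdj x x') _ (vecEq eq4 x x') _ _ (Sh.vecAdj⇒¬vecEq x x')

  sh-part : (∑[ x' ∈ X ] ∑[ y' ∈ Y ] vecAdj eq4 shAdj x x' · (vecEq eq2 y y' · (P (x' , y') · 1)))
            ≡ ∑[ i ∈ allFin m ] nbrsInSh (shLine P (x , y) i) (lookup x i)
  sh-part = begin
    (∑[ x' ∈ X ] ∑[ y' ∈ Y ] vecAdj eq4 shAdj x x' · (vecEq eq2 y y' · (P (x' , y') · 1)))
      ≡⟨ ∑-cong X (λ x' → trans (∑-·ˡ Y (vecAdj eq4 shAdj x x') _)
                                 (cong (vecAdj eq4 shAdj x x' ·_) (K.vecEq-select y (λ y' → P (x' , y') · 1)))) ⟩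
    (∑[ x' ∈ X ] vecAdj eq4 shAdj x x' · (P (x' , y) · 1))
      ≡⟨ Sh.vecAdj-lines x (λ x' → P (x' , y) · 1) ⟩
    (∑[ i ∈ allFin m ] nbrsInSh (shLine P (x , y) i) (lookup x i)) ∎

  k-part : (∑[ x' ∈ X ] ∑[ y' ∈ Y ] vecEq eq4 x x' · (vecAdj eq2 kAdj y y' · (P (x' , y') · 1)))
           ≡ ∑[ j ∈ allFin n ] nbrsInK (kLine P (x , y) j) (lookup y j)
  k-part = begin
    (∑[ x' ∈ X ] ∑[ y' ∈ Y ] vecEq eq4 x x' · (vecAdj eq2 kAdj y y' · (P (x' , y') · 1)))
      ≡⟨ ∑-cong X (λ x' → ∑-·ˡ Y (vecEq eq4 x x') _) ⟩
    (∑[ x' ∈ X ] vecEq eq4 x x' · (∑[ y' ∈ Y ] vecAdj eq2 kAdj y y' · (P (x' , y') · 1)))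
      ≡⟨ Sh.vecEq-select x (λ x' → ∑[ y' ∈ Y ] vecAdj eq2 kAdj y y' · (P (x' , y') · 1)) ⟩
    (∑[ y' ∈ Y ] vecAdj eq2 kAdj y y' · (P (x , y') · 1))
      ≡⟨ K.vecAdj-lines y (λ y' → P (x , y') · 1) ⟩
    (∑[ j ∈ allFin n ] nbrsInK (kLine P (x , y) j) (lookup y j)) ∎

nbrsIn-by-lines : ∀ {m n} (P : VSet m n) v {s k : ℕ} →
                  (∀ i → nbrsInSh (shLine P v i) (lookup (proj₁ v) i) ≡ s) →
                  (∀ j → nbrsInK (kLine P v j) (lookup (proj₂ v) j) ≡ k) →
                  nbrsIn P v ≡ m * s + n * k
nbrsIn-by-lines {m} {n} P (x , y) {s} {k} on-sh on-k =
  trans (nbrsIn-lines P x y) (cong₂ _+_ (trans (∑-cong (allFin m) on-sh) (∑-allFin-const m s))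
                                         (trans (∑-cong (allFin n) on-k) (∑-allFin-const n k)))

degree : ∀ {m n} (v : Vertex m n) → nbrsIn (λ _ → true) v ≡ 6 * m + 3 * n
degree {m} {n} v = trans
  (nbrsIn-by-lines (λ _ → true) v {6} {3}
    (λ i → trans (nbrsAmong-cong shAdj allZ4² {shLine (λ _ → true) v i} {λ _ → true} (lookup (proj₁ v) i) (λ _ → refl))
                 (shDegree (lookup (proj₁ v) i)))
    (λ j → trans (nbrsAmong-cong kAdj allZ2² {kLine (λ _ → true) v j} {λ _ → true} (lookup (proj₂ v) j) (λ _ → refl))
                 (kDegree (lookup (proj₂ v) j))))
  (cong₂ _+_ (*-comm m 6) (*-comm n 3))

nbrsIn-complement : ∀ {m n} (C : VSet m n) v {a b : ℕ} → nbrsIn C v ≡ a → a + b ≡ 6 * m + 3 * n →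
                    nbrsIn (complement C) v ≡ b
nbrsIn-complement {m} {n} C v {a} {b} Cv≡a a+b≡ = +-cancelˡ-≡ a _ b (begin
  a + nbrsIn (complement C) v                       ≡⟨ cong₂ _+_ (sym Cv≡a) (nbrsIn-nbrsAmong (complement C) v) ⟩
  nbrsIn C v + nbrsAmong adj V (complement C) v     ≡⟨ cong (_+ nbrsAmong adj V (complement C) v) (nbrsIn-nbrsAmong C v) ⟩
  nbrsAmong adj V C v + nbrsAmong adj V (complement C) v ≡⟨ nbrsAmong-complement adj V C v ⟩
  nbrsAmong adj V (λ _ → true) v                    ≡⟨ nbrsIn-nbrsAmong (λ _ → true) v ⟨
  nbrsIn (λ _ → true) v                             ≡⟨ degree v ⟩
  6 * m + 3 * n                                     ≡⟨ a+b≡ ⟨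
  a + b                                             ∎)
  where
  open ≡-Reasoning
  V : List (Vertex m n)
  V = allVertices m n

shUpdate : ∀ {m n} → Vertex m n → Fin m → Z4² → Vertex m n
shUpdate (x , y) i a = (x [ i ]≔ a , y)

kUpdate : ∀ {m n} → Vertex m n → Fin n → Z2² → Vertex m n
kUpdate (x , y) j c = (x , y [ j ]≔ c)

∑-shLines : ∀ {m n} (i : Fin m) (f : Vertex m n → ℕ) →
            ∑[ v ∈ allVertices m n ] ∑[ a ∈ allZ4² ] f (shUpdate v i a) ≡ 16 * ∑ (allVertices m n) f
∑-shLines {m} {n} i f = begin
  ∑[ v ∈ allVertices m n ] ∑[ a ∈ allZ4² ] f (shUpdate v i a)  ≡⟨ ∑-product _,_ X Y _ ⟩
  ∑[ x ∈ X ] ∑[ y ∈ Y ] ∑[ a ∈ allZ4² ] f (x [ i ]≔ a , y)     ≡⟨ ∑-swap X Y _ ⟩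
  ∑[ y ∈ Y ] ∑[ x ∈ X ] ∑[ a ∈ allZ4² ] f (x [ i ]≔ a , y)     ≡⟨ ∑-cong Y (λ y → ∑-update allZ4² i (λ x → f (x , y))) ⟩
  ∑[ y ∈ Y ] 16 * (∑[ x ∈ X ] f (x , y))                       ≡⟨ ∑-*ˡ Y 16 _ ⟩
  16 * (∑[ y ∈ Y ] ∑[ x ∈ X ] f (x , y))                       ≡⟨ cong (16 *_) (∑-swap Y X _) ⟩
  16 * (∑[ x ∈ X ] ∑[ y ∈ Y ] f (x , y))                       ≡⟨ cong (16 *_) (∑-product _,_ X Y f) ⟨
  16 * ∑ (allVertices m n) f                                   ∎
  where
  open ≡-Reasoning
  X : List (Vec Z4² m)
  X = allVec allZ4² m
  Y : List (Vec Z2² n)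
  Y = allVec allZ2² n

∑-kLines : ∀ {m n} (j : Fin n) (f : Vertex m n → ℕ) →
           ∑[ v ∈ allVertices m n ] ∑[ c ∈ allZ2² ] f (kUpdate v j c) ≡ 4 * ∑ (allVertices m n) f
∑-kLines {m} {n} j f = begin
  ∑[ v ∈ allVertices m n ] ∑[ c ∈ allZ2² ] f (kUpdate v j c)  ≡⟨ ∑-product _,_ X Y _ ⟩
  ∑[ x ∈ X ] ∑[ y ∈ Y ] ∑[ c ∈ allZ2² ] f (x , y [ j ]≔ c)    ≡⟨ ∑-cong X (λ x → ∑-update allZ2² j (λ y → f (x , y))) ⟩
  ∑[ x ∈ X ] 4 * (∑[ y ∈ Y ] f (x , y))                       ≡⟨ ∑-*ˡ X 4 _ ⟩
  4 * (∑[ x ∈ X ] ∑[ y ∈ Y ] f (x , y))                       ≡⟨ cong (4 *_) (∑-product _,_ X Y f) ⟨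
  4 * ∑ (allVertices m n) f                                   ∎
  where
  open ≡-Reasoning
  X : List (Vec Z4² m)
  X = allVec allZ4² m
  Y : List (Vec Z2² n)
  Y = allVec allZ2² n

lookup-shUpdate : ∀ {m n} (v : Vertex m n) i a → lookup (proj₁ (shUpdate v i a)) i ≡ a
lookup-shUpdate (x , y) i a = lookup∘update i x a

lookup-kUpdate : ∀ {m n} (v : Vertex m n) j c → lookup (proj₂ (kUpdate v j c)) j ≡ c
lookup-kUpdate (x , y) j c = lookup∘update j y c

shLine-shUpdate : ∀ {m n} (C : VSet m n) v i a b → shLine C (shUpdate v i a) i b ≡ shLine C v i b
shLine-shUpdate C (x , y) i a b = cong (λ x' → C (x' , y)) ([]≔-idempotent x i)

kLine-kUpdate : ∀ {m n} (C : VSet m n) v j c d → kLine C (kUpdate v j c) j d ≡ kLine C v j d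
kLine-kUpdate C (x , y) j c d = cong (λ y' → C (x , y')) ([]≔-idempotent y j)

shLine-centre : ∀ {m n} (C : VSet m n) v i → shLine C v i (lookup (proj₁ v) i) ≡ C v
shLine-centre C (x , y) i = cong (λ x' → C (x' , y)) ([]≔-lookup x i)

kLine-centre : ∀ {m n} (C : VSet m n) v j → kLine C v j (lookup (proj₂ v) j) ≡ C v
kLine-centre C (x , y) j = cong (λ y' → C (x , y')) ([]≔-lookup y j)

∧true-∨-∧false : ∀ p e → (p ∧ true) ∨ (e ∧ false) ≡ p
∧true-∨-∧false true  e     = refl
∧true-∨-∧false false true  = refl
∧true-∨-∧false false false = refl

adj-shUpdate : ∀ {m n} (v : Vertex m n) i a b → adj (shUpdate v i a) (shUpdate v i b) ≡ shAdj a b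
adj-shUpdate (x , y) i a b = begin
  (vecAdj eq4 shAdj x⁺ x⁻ ∧ vecEq eq2 y y) ∨ (vecEq eq4 x⁺ x⁻ ∧ vecAdj eq2 kAdj y y)
    ≡⟨ cong₂ (λ e r → (vecAdj eq4 shAdj x⁺ x⁻ ∧ e) ∨ (vecEq eq4 x⁺ x⁻ ∧ r)) (K.vecEq-refl y) (K.vecAdj-irrefl y) ⟩
  (vecAdj eq4 shAdj x⁺ x⁻ ∧ true) ∨ (vecEq eq4 x⁺ x⁻ ∧ false)
    ≡⟨ ∧true-∨-∧false _ _ ⟩
  vecAdj eq4 shAdj x⁺ x⁻
    ≡⟨ Sh.vecAdj-update x i a b ⟩
  shAdj a b ∎
  where
  open ≡-Reasoning
  x⁺ = x [ i ]≔ a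
  x⁻ = x [ i ]≔ b

adj-kUpdate : ∀ {m n} (v : Vertex m n) j c d → adj (kUpdate v j c) (kUpdate v j d) ≡ kAdj c d
adj-kUpdate (x , y) j c d = begin
  (vecAdj eq4 shAdj x x ∧ vecEq eq2 y⁺ y⁻) ∨ (vecEq eq4 x x ∧ vecAdj eq2 kAdj y⁺ y⁻)
    ≡⟨ cong₂ (λ r e → (r ∧ vecEq eq2 y⁺ y⁻) ∨ (e ∧ vecAdj eq2 kAdj y⁺ y⁻)) (Sh.vecAdj-irrefl x) (Sh.vecEq-refl x) ⟩
  vecAdj eq2 kAdj y⁺ y⁻
    ≡⟨ K.vecAdj-update y j c d ⟩
  kAdj c d ∎
  where
  open ≡-Reasoning
  y⁺ = y [ j ]≔ c
  y⁻ = y [ j ]≔ d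

shLine-independent : ∀ {m n} {C : VSet m n} → Independent C → ∀ v i → IndependentSh (shLine C v i)
shLine-independent ind v i a b Ca Cb = trans (sym (adj-shUpdate v i a b)) (ind _ _ Ca Cb)

kLine-independent : ∀ {m n} {C : VSet m n} → Independent C → ∀ v j → IndependentK (kLine C v j)
kLine-independent ind v j c d Cc Cd = trans (sym (adj-kUpdate v j c d)) (ind _ _ Cc Cd)

16^m≡4^[m+m] : ∀ m → 16 ^ m ≡ 4 ^ (m + m)
16^m≡4^[m+m] zero    = refl
16^m≡4^[m+m] (suc m) = begin
  16 * 16 ^ m          ≡⟨ cong (16 *_) (16^m≡4^[m+m] m) ⟩
  16 * 4 ^ (m + m)     ≡⟨ *-assoc 4 4 (4 ^ (m + m)) ⟩
  4 * 4 ^ suc (m + m)  ≡⟨ cong (λ e → 4 * 4 ^ e) (+-suc m m) ⟨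
  4 ^ (suc m + suc m)  ∎
  where open ≡-Reasoning

vertexCount : ∀ m n → length (allVertices m n) ≡ 4 ^ (m + m + n)
vertexCount m n = begin
  length (allVertices m n)                             ≡⟨ length-product _,_ (allVec allZ4² m) (allVec allZ2² n) ⟩
  length (allVec allZ4² m) * length (allVec allZ2² n)  ≡⟨ cong₂ _*_ (length-allVec allZ4² m) (length-allVec allZ2² n) ⟩
  16 ^ m * 4 ^ n                                       ≡⟨ cong (_* 4 ^ n) (16^m≡4^[m+m] m) ⟩
  4 ^ (m + m) * 4 ^ n                                  ≡⟨ ^-distribˡ-+-* 4 (m + m) n ⟨
  4 ^ (m + m + n)                                      ∎
  where open ≡-Reasoning

card-complement : ∀ {m n} (C : VSet m n) → card C + card (complement C) ≡ 4 ^ (m + m + n)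
card-complement {m} {n} C = trans (countL-complement C (allVertices m n)) (vertexCount m n)

-- Facts about Sh and K, checked on all subsets

Grid : ℕ → Set
Grid k = Vec (Vec Bool k) k

fromGrid : ∀ {k} → Grid k → Fin k × Fin k → Bool
fromGrid M (i , j) = lookup (lookup M i) j

toGrid : ∀ {k} → (Fin k × Fin k → Bool) → Grid k
toGrid S = tabulate (λ i → tabulate (λ j → S (i , j)))

fromGrid-toGrid : ∀ {k} (S : Fin k × Fin k → Bool) a → fromGrid (toGrid S) a ≡ S a
fromGrid-toGrid S (i , j) =
  trans (cong (λ r → lookup r j) (lookup∘tabulate (λ i → tabulate (λ j → S (i , j))) i)) (lookup∘tabulate (λ j → S (i , j)) j)

allGrids : ∀ k → List (Grid k)
allGrids k = allVec (allVec (true ∷ false ∷ []) k) k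

everyGrid : ∀ {k} {P : Grid k → Set} → All P (allGrids k) → ∀ M → P M
everyGrid = byExhaustion (∈-allVec (∈-allVec ∈-bools))
  where
  ∈-bools : ∀ b → b ∈ true ∷ false ∷ []
  ∈-bools true  = here refl
  ∈-bools false = there (here refl)

cutSh : (Z4² → Bool) → ℕ
cutSh S = ∑[ a ∈ allZ4² ] nbrsInSh (λ b → S a xor S b) a

cutK : (Z2² → Bool) → ℕ
cutK S = ∑[ c ∈ allZ2² ] nbrsInK (λ d → S c xor S d) c

next : Fin 4 → Fin 4
next zero                   = suc zero
next (suc zero)             = suc (suc zero)
next (suc (suc zero))       = suc (suc (suc zero))
next (suc (suc (suc zero))) = zero

shEdges : List (Z4² × Z4²)
shEdges = concatMap (λ (i , j) → ((i , j) , (i , next j)) ∷ ((i , j) , (next i , j)) ∷ ((i , j) , (next i , next j)) ∷ []) allZ4²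

edgeTerm : (Bool → Bool → Bool) → (Z4² → Bool) → Z4² × Z4² → ℕ
edgeTerm _⊙_ S (a , b) = (S a ⊙ S b) · 1

-- Twelve edges of Sh start in row r: to the right neighbour in r, and to the two points of the next row s
-- that differ by (1,0) and (1,1).  Summing row by row evaluates much faster than a sum over shEdges.
rowEdges : (Bool → Bool → Bool) → Vec Bool 4 → Vec Bool 4 → ℕ → ℕ
rowEdges _⊙_ (a₀ ∷ a₁ ∷ a₂ ∷ a₃ ∷ []) (b₀ ∷ b₁ ∷ b₂ ∷ b₃ ∷ []) rest =
  (a₀ ⊙ a₁) · 1 + ((a₀ ⊙ b₀) · 1 + ((a₀ ⊙ b₁) · 1 +
  ((a₁ ⊙ a₂) · 1 + ((a₁ ⊙ b₁) · 1 + ((a₁ ⊙ b₂) · 1 +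
  ((a₂ ⊙ a₃) · 1 + ((a₂ ⊙ b₂) · 1 + ((a₂ ⊙ b₃) · 1 +
  ((a₃ ⊙ a₀) · 1 + ((a₃ ⊙ b₃) · 1 + ((a₃ ⊙ b₀) · 1 + rest)))))))))))

edgeSum : (Bool → Bool → Bool) → Grid 4 → ℕ
edgeSum _⊙_ (r₀ ∷ r₁ ∷ r₂ ∷ r₃ ∷ []) = rowEdges _⊙_ r₀ r₁ (rowEdges _⊙_ r₁ r₂ (rowEdges _⊙_ r₂ r₃ (rowEdges _⊙_ r₃ r₀ 0)))

edgeSum-∑ : ∀ _⊙_ M → edgeSum _⊙_ M ≡ ∑ shEdges (edgeTerm _⊙_ (fromGrid M))
edgeSum-∑ _⊙_ ((_ ∷ _ ∷ _ ∷ _ ∷ []) ∷ (_ ∷ _ ∷ _ ∷ _ ∷ []) ∷ (_ ∷ _ ∷ _ ∷ _ ∷ []) ∷ (_ ∷ _ ∷ _ ∷ _ ∷ []) ∷ []) = refl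

edgeSum-toGrid : ∀ _⊙_ S → edgeSum _⊙_ (toGrid S) ≡ ∑ shEdges (edgeTerm _⊙_ S)
edgeSum-toGrid _⊙_ S = trans (edgeSum-∑ _⊙_ (toGrid S))
  (∑-cong shEdges (λ (a , b) → cong₂ (λ x y → (x ⊙ y) · 1) (fromGrid-toGrid S a) (fromGrid-toGrid S b)))

shEdges-adjacent : All (λ e → shAdj (proj₁ e) (proj₂ e) ≡ true) shEdges
shEdges-adjacent = from-yes (all? (λ e → shAdj (proj₁ e) (proj₂ e) Bool.≟ true) shEdges)

xor-comm : ∀ a b → a xor b ≡ b xor a
xor-comm true  true  = refl
xor-comm true  false = refl
xor-comm false true  = refl
xor-comm false false = refl

[b·1]*n≡b·n : ∀ b n → (b · 1) * n ≡ b · n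
[b·1]*n≡b·n true  n = +-identityʳ n
[b·1]*n≡b·n false n = refl

_≟ₑ_ : DecidableEquality (Z4² × Z4²)
_≟ₑ_ = ≡-dec _≟₄_ _≟₄_

selectPairs : Selecting _≟ₑ_ (pairs allZ4² allZ4²)
selectPairs = selecting _≟ₑ_ (pairs allZ4² allZ4²) (byExhaustion (∈-pairs ∈-allZ4² ∈-allZ4²)
  (from-yes (all? (λ p → countL (λ u → ⌊ p ≟ₑ u ⌋) (pairs allZ4² allZ4²) ℕ.≟ 1) (pairs allZ4² allZ4²))))

-- Every edge of Sh occurs in shEdges exactly once, in one of its two orientations.
cutSh-edges : ∀ S → cutSh S ≡ 2 * ∑ shEdges (edgeTerm _xor_ S)
cutSh-edges S = begin
  cutSh S
    ≡⟨ ∑-product _,_ allZ4² allZ4² (λ u → shAdj (proj₁ u) (proj₂ u) · d u) ⟨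
  ∑[ u ∈ pairs allZ4² allZ4² ] shAdj (proj₁ u) (proj₂ u) · d u
    ≡⟨ ∑-cong (pairs allZ4² allZ4²) (λ u → trans (sym ([b·1]*n≡b·n (shAdj (proj₁ u) (proj₂ u)) (d u)))
                                                  (cong (_* d u) (sym (multiplicity u)))) ⟩
  ∑[ u ∈ pairs allZ4² allZ4² ] countL (λ p → ⌊ p ≟ₑ u ⌋) bothWays * d u
    ≡⟨ ∑-multiplicity _≟ₑ_ (pairs allZ4² allZ4²) selectPairs bothWays d ⟨
  ∑ bothWays d
    ≡⟨ ∑-++ shEdges (map swap shEdges) d ⟩
  ∑ shEdges d + ∑ (map swap shEdges) d
    ≡⟨ cong (∑ shEdges d +_) (trans (∑-map swap shEdges d) (∑-cong shEdges (λ (a , b) → cong (_· 1) (xor-comm (S b) (S a))))) ⟩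
  ∑ shEdges d + ∑ shEdges d
    ≡⟨ cong (∑ shEdges d +_) (+-identityʳ (∑ shEdges d)) ⟨
  2 * ∑ shEdges d ∎
  where
  open ≡-Reasoning
  d : Z4² × Z4² → ℕ
  d = edgeTerm _xor_ S
  bothWays : List (Z4² × Z4²)
  bothWays = shEdges ++ map swap shEdges
  multiplicity : ∀ u → countL (λ p → ⌊ p ≟ₑ u ⌋) bothWays ≡ shAdj (proj₁ u) (proj₂ u) · 1
  multiplicity = byExhaustion (∈-pairs ∈-allZ4² ∈-allZ4²)
    (from-yes (all? (λ u → countL (λ p → ⌊ p ≟ₑ u ⌋) bothWays ℕ.≟ shAdj (proj₁ u) (proj₂ u) · 1) (pairs allZ4² allZ4²)))

_⊖_ : Z4² → Z4² → Z4²
(a₁ , a₂) ⊖ (c₁ , c₂) = (sub4 a₁ c₁ , sub4 a₂ c₂)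

-- The cosets c + H of the four subgroups H of Z4² of order 4 that meet the connection set of Sh
-- only in 0, each subgroup listed with a set of coset representatives c.
cocliques : List (Z4² → Bool)
cocliques = concatMap (λ (H , reps) → map (λ c a → any (λ h → ⌊ (a ⊖ c) ≟₄ h ⌋) H) reps) subgroups
  where
  subgroups : List (List Z4² × List Z4²)
  subgroups = (((# 0 , # 0) ∷ (# 0 , # 2) ∷ (# 2 , # 0) ∷ (# 2 , # 2) ∷ []) , reps₁)
            ∷ (((# 0 , # 0) ∷ (# 0 , # 2) ∷ (# 2 , # 1) ∷ (# 2 , # 3) ∷ []) , reps₁)
            ∷ (((# 0 , # 0) ∷ (# 1 , # 2) ∷ (# 2 , # 0) ∷ (# 3 , # 2) ∷ []) , reps₁)
            ∷ (((# 0 , # 0) ∷ (# 1 , # 3) ∷ (# 2 , # 2) ∷ (# 3 , # 1) ∷ []) , reps₂) ∷ []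
    where
    reps₁ reps₂ : List Z4²
    reps₁ = (# 0 , # 0) ∷ (# 0 , # 1) ∷ (# 1 , # 0) ∷ (# 1 , # 1) ∷ []
    reps₂ = (# 0 , # 0) ∷ (# 0 , # 1) ∷ (# 0 , # 2) ∷ (# 0 , # 3) ∷ []

IndependentSh′ : (Z4² → Bool) → Set
IndependentSh′ S = All (λ a → All (λ b → S a ≡ true → S b ≡ true → shAdj a b ≡ false) allZ4²) allZ4²

independentSh? : ∀ S → Dec (IndependentSh′ S)
independentSh? S = all? (λ a → all? (λ b → S a Bool.≟ true →-dec (S b Bool.≟ true →-dec shAdj a b Bool.≟ false)) allZ4²) allZ4²

IndependentSh′⇒IndependentSh : ∀ S → IndependentSh′ S → IndependentSh S
IndependentSh′⇒IndependentSh S ind a b = byExhaustion ∈-allZ4² (byExhaustion ∈-allZ4² ind a) b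

cocliques-independent : All (λ A → cardSh A ≡ 4 × IndependentSh′ A) cocliques
cocliques-independent = from-yes (all? (λ A → cardSh A ℕ.≟ 4 ×-dec independentSh? A) cocliques)

_∖_ : (Z4² → Bool) → (Z4² → Bool) → Z4² → Bool
(S ∖ A) a = S a ∧ not (A a)

SplitsOff : (Z4² → Bool) → (Z4² → Bool) → Set
SplitsOff S A = All (λ a → A a ≡ true → S a ≡ true) allZ4² × cardSh (S ∖ A) ≡ 4 × IndependentSh′ (S ∖ A)

MaxCutShape : (Z4² → Bool) → Set
MaxCutShape S = cardSh S ≡ 8 × Any (SplitsOff S) cocliques

CutBound : ℕ → (Z4² → Bool) → Set
CutBound e S = e ≤ 32 × (e ≡ 32 → MaxCutShape S)

cutCheck : ∀ M → CutBound (edgeSum _xor_ M) (fromGrid M)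
cutCheck = everyGrid (from-yes (all? (λ M → cutBound? (edgeSum _xor_ M) (fromGrid M)) (allGrids 4)))
  where
  cutBound? : ∀ e S → Dec (CutBound e S)
  cutBound? e S = (e ≤? 32) ×-dec ((e ℕ.≟ 32) →-dec (cardSh S ℕ.≟ 8 ×-dec any? (λ A →
    all? (λ a → A a Bool.≟ true →-dec S a Bool.≟ true) allZ4² ×-dec cardSh (S ∖ A) ℕ.≟ 4 ×-dec independentSh? (S ∖ A)) cocliques))

CocliqueBound : ℕ → (Z4² → Bool) → Set
CocliqueBound e S = e ≡ 0 → cardSh S ≤ 4 × (cardSh S ≡ 4 → All (λ a → S a ≡ false → nbrsInSh S a ≡ 2) allZ4²)

cocliqueCheck : ∀ M → CocliqueBound (edgeSum _∧_ M) (fromGrid M)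
cocliqueCheck = everyGrid (from-yes (all? (λ M → cocliqueBound? (edgeSum _∧_ M) (fromGrid M)) (allGrids 4)))
  where
  cocliqueBound? : ∀ e S → Dec (CocliqueBound e S)
  cocliqueBound? e S = (e ℕ.≟ 0) →-dec ((cardSh S ≤? 4) ×-dec
    ((cardSh S ℕ.≟ 4) →-dec all? (λ a → S a Bool.≟ false →-dec nbrsInSh S a ℕ.≟ 2) allZ4²))

cardSh-cong : ∀ S S' → (∀ a → S a ≡ S' a) → cardSh S ≡ cardSh S'
cardSh-cong S S' = countL-cong allZ4² {S} {S'}

UnionTwoIndep4-cong : ∀ S S' → (∀ a → S a ≡ S' a) → UnionTwoIndep4 S → UnionTwoIndep4 S'
UnionTwoIndep4-cong S S' S≗S' (card8 , A , B , cardA , cardB , indA , indB , disjoint , union) =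
  trans (sym (cardSh-cong S S' S≗S')) card8 , A , B , cardA , cardB , indA , indB , disjoint ,
  λ a → trans (sym (S≗S' a)) (union a)

∖-disjoint : ∀ a s → a ∧ (s ∧ not a) ≡ false
∖-disjoint true  s = ∧-zeroʳ s
∖-disjoint false s = refl

∖-union : ∀ a s → (a ≡ true → s ≡ true) → s ≡ a ∨ (s ∧ not a)
∖-union true  s a⇒s = a⇒s refl
∖-union false s _   = sym (∧-identityʳ s)

maxCutShape⇒UnionTwoIndep4 : ∀ S → MaxCutShape S → UnionTwoIndep4 S
maxCutShape⇒UnionTwoIndep4 S (card8 , splits) = split-along (find splits)
  where
  split-along : Σ (Z4² → Bool) (λ A → A ∈ cocliques × SplitsOff S A) → UnionTwoIndep4 S
  split-along (A , A∈cocliques , A⊆S , cardB , indB) =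
    card8 , A , S ∖ A , proj₁ A-ok , cardB ,
    IndependentSh′⇒IndependentSh A (proj₂ A-ok) , IndependentSh′⇒IndependentSh (S ∖ A) indB ,
    (λ a → ∖-disjoint (A a) (S a)) , (λ a → ∖-union (A a) (S a) (byExhaustion ∈-allZ4² A⊆S a))
    where
    A-ok : cardSh A ≡ 4 × IndependentSh′ A
    A-ok = All.lookup cocliques-independent A∈cocliques

shCut-bound : ∀ S → cutSh S ≤ 64
shCut-bound S = begin
  cutSh S                            ≡⟨ cutSh-edges S ⟩
  2 * ∑ shEdges (edgeTerm _xor_ S)   ≡⟨ cong (2 *_) (edgeSum-toGrid _xor_ S) ⟨
  2 * edgeSum _xor_ (toGrid S)       ≤⟨ *-monoʳ-≤ 2 (proj₁ (cutCheck (toGrid S))) ⟩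
  64                                 ∎
  where open ≤-Reasoning

shCut-max : ∀ S → cutSh S ≡ 64 → UnionTwoIndep4 S
shCut-max S cut≡64 = UnionTwoIndep4-cong (fromGrid (toGrid S)) S (fromGrid-toGrid S)
  (maxCutShape⇒UnionTwoIndep4 (fromGrid (toGrid S)) (proj₂ (cutCheck (toGrid S)) (*-cancelˡ-≡ _ 32 2 edges≡64)))
  where
  edges≡64 : 2 * edgeSum _xor_ (toGrid S) ≡ 2 * 32
  edges≡64 = trans (cong (2 *_) (edgeSum-toGrid _xor_ S)) (trans (sym (cutSh-edges S)) cut≡64)

module _ {S : Z4² → Bool} (ind : IndependentSh S) where

  private
    bound : CocliqueBound (edgeSum _∧_ (toGrid S)) (fromGrid (toGrid S))
    bound = cocliqueCheck (toGrid S)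

    no-inner-edge : edgeSum _∧_ (toGrid S) ≡ 0
    no-inner-edge = trans (edgeSum-toGrid _∧_ S) (∑-All-zero {f = edgeTerm _∧_ S} (All.map no-edge shEdges-adjacent))
      where
      no-edge : ∀ {e} → shAdj (proj₁ e) (proj₂ e) ≡ true → edgeTerm _∧_ S e ≡ 0
      no-edge {a , b} ab with S a in Sa | S b in Sb
      ... | true  | true  = contradiction (trans (sym ab) (ind a b Sa Sb)) λ ()
      ... | true  | false = refl
      ... | false | _     = refl

    card≡ : cardSh (fromGrid (toGrid S)) ≡ cardSh S
    card≡ = cardSh-cong (fromGrid (toGrid S)) S (fromGrid-toGrid S)

  shCoclique-bound : cardSh S ≤ 4
  shCoclique-bound = subst (_≤ 4) card≡ (proj₁ (bound no-inner-edge))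

  shCoclique-nbrs : cardSh S ≡ 4 → ∀ a → S a ≡ false → nbrsInSh S a ≡ 2
  shCoclique-nbrs card4 a Sa =
    trans (nbrsAmong-cong shAdj allZ4² {S} {fromGrid (toGrid S)} a (λ b → sym (fromGrid-toGrid S b)))
          (byExhaustion ∈-allZ4² (proj₂ (bound no-inner-edge) (trans card≡ card4)) a (trans (fromGrid-toGrid S a) Sa))

IndependentK′ : (Z2² → Bool) → Set
IndependentK′ S = All (λ c → All (λ d → S c ≡ true → S d ≡ true → kAdj c d ≡ false) allZ2²) allZ2²

KFacts : (Z2² → Bool) → Set
KFacts S = (cutK S ≤ 8 × (cutK S ≡ 8 → cardK S ≡ 2))
         × (IndependentK′ S → cardK S ≤ 1 × (cardK S ≡ 1 → All (λ c → S c ≡ false → nbrsInK S c ≡ 1) allZ2²))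
         × (cardK S ≡ 2 → All (λ c → (S c ≡ true → nbrsInK S c ≡ 1) × (S c ≡ false → nbrsInK S c ≡ 2)) allZ2²)

kCheck : ∀ M → KFacts (fromGrid M)
kCheck = everyGrid (from-yes (all? (λ M → kFacts? (fromGrid M)) (allGrids 2)))
  where
  kFacts? : ∀ S → Dec (KFacts S)
  kFacts? S =
    ((cutK S ≤? 8) ×-dec (cutK S ℕ.≟ 8 →-dec cardK S ℕ.≟ 2))
    ×-dec (all? (λ c → all? (λ d → S c Bool.≟ true →-dec (S d Bool.≟ true →-dec kAdj c d Bool.≟ false)) allZ2²) allZ2²
           →-dec ((cardK S ≤? 1) ×-dec (cardK S ℕ.≟ 1 →-dec all? (λ c → S c Bool.≟ false →-dec nbrsInK S c ℕ.≟ 1) allZ2²)))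
    ×-dec (cardK S ℕ.≟ 2 →-dec
           all? (λ c → (S c Bool.≟ true →-dec nbrsInK S c ℕ.≟ 1) ×-dec (S c Bool.≟ false →-dec nbrsInK S c ℕ.≟ 2)) allZ2²)

module _ (S : Z2² → Bool) where

  private
    S′ : Z2² → Bool
    S′ = fromGrid (toGrid S)

    S′≗S : ∀ c → S′ c ≡ S c
    S′≗S = fromGrid-toGrid S

    facts : KFacts S′
    facts = kCheck (toGrid S)

    card≡ : cardK S′ ≡ cardK S
    card≡ = countL-cong allZ2² {S′} {S} S′≗S

    nbrs≡ : ∀ c → nbrsInK S′ c ≡ nbrsInK S c
    nbrs≡ c = nbrsAmong-cong kAdj allZ2² {S′} {S} c S′≗S

    cut≡ : cutK S′ ≡ cutK S
    cut≡ = ∑-cong allZ2² (λ c → nbrsAmong-cong kAdj allZ2² {λ d → S′ c xor S′ d} {λ d → S c xor S d} c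
                                                (λ d → cong₂ _xor_ (S′≗S c) (S′≗S d)))

  kCut-bound : cutK S ≤ 8
  kCut-bound = subst (_≤ 8) cut≡ (proj₁ (proj₁ facts))

  kCut-max : cutK S ≡ 8 → cardK S ≡ 2
  kCut-max cut8 = trans (sym card≡) (proj₂ (proj₁ facts) (trans cut≡ cut8))

  module _ (ind : IndependentK S) where

    private
      coclique-facts : cardK S′ ≤ 1 × (cardK S′ ≡ 1 → All (λ c → S′ c ≡ false → nbrsInK S′ c ≡ 1) allZ2²)
      coclique-facts = proj₁ (proj₂ facts) (All.tabulate λ {c} _ → All.tabulate λ {d} _ S′c S′d →
                         ind c d (trans (sym (S′≗S c)) S′c) (trans (sym (S′≗S d)) S′d))

    kCoclique-bound : cardK S ≤ 1
    kCoclique-bound = subst (_≤ 1) card≡ (proj₁ coclique-facts)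

    kCoclique-nbrs : cardK S ≡ 1 → ∀ c → S c ≡ false → nbrsInK S c ≡ 1
    kCoclique-nbrs card1 c Sc = trans (sym (nbrs≡ c))
      (byExhaustion ∈-allZ2² (proj₂ coclique-facts (trans card≡ card1)) c (trans (S′≗S c) Sc))

  kHalf-nbrs : cardK S ≡ 2 → ∀ c → nbrsInK S c ≡ (if S c then 1 else 2)
  kHalf-nbrs card2 c = by-membership (S c) refl
    where
    half : (S′ c ≡ true → nbrsInK S′ c ≡ 1) × (S′ c ≡ false → nbrsInK S′ c ≡ 2)
    half = byExhaustion ∈-allZ2² (proj₂ (proj₂ facts) (trans card≡ card2)) c
    by-membership : ∀ s → S c ≡ s → nbrsInK S c ≡ (if s then 1 else 2)
    by-membership true  Sc = trans (sym (nbrs≡ c)) (proj₁ half (trans (S′≗S c) Sc))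
    by-membership false Sc = trans (sym (nbrs≡ c)) (proj₂ half (trans (S′≗S c) Sc))

-- (a) MDS codes

4^-pred : ∀ e → 1 ≤ e → 4 ^ e ≡ 4 * 4 ^ (e ∸ 1)
4^-pred (suc e) _ = refl

MDS-size⇔ : ∀ m n → 1 ≤ 2 * m + n → ∀ c → c ≡ 4 ^ ((m + m + n) ∸ 1) ⇔ 4 * c ≡ 4 ^ (m + m + n)
MDS-size⇔ m n pos c = mk⇔ (λ c≡ → trans (cong (4 *_) c≡) (sym pow)) (λ 4c≡ → *-cancelˡ-≡ c _ 4 (trans 4c≡ pow))
  where
  2m+n≡m+m+n : ∀ m n → 2 * m + n ≡ m + m + n
  2m+n≡m+m+n = solve 2 (λ m n → con 2 :* m :+ n := m :+ m :+ n) refl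
  pow : 4 ^ (m + m + n) ≡ 4 * 4 ^ ((m + m + n) ∸ 1)
  pow = 4^-pred (m + m + n) (subst (1 ≤_) (2m+n≡m+m+n m n) pos)

not≡true : ∀ {b} → not b ≡ true → b ≡ false
not≡true {false} _ = refl

module LineCounts {m n : ℕ} {C : VSet m n} (ind : Independent C) (size : 4 * card C ≡ 4 ^ (m + m + n)) where

  private
    V : List (Vertex m n)
    V = allVertices m n

    4*card : 4 * card C ≡ length V
    4*card = trans size (sym (vertexCount m n))

  shLine-card : ∀ v i → cardSh (shLine C v i) ≡ 4
  shLine-card v i = ∑-mono-tight V {λ w → cardSh (shLine C w i)} {λ _ → 4}
    (λ w → shCoclique-bound {shLine C w i} (shLine-independent ind w i)) (≤-reflexive total) (∈-allVertices v)
    where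
    total : ∑[ w ∈ V ] 4 ≡ ∑[ w ∈ V ] cardSh (shLine C w i)
    total = begin
      ∑[ w ∈ V ] 4                                          ≡⟨ ∑-const V 4 ⟩
      length V * 4                                          ≡⟨ *-comm (length V) 4 ⟩
      4 * length V                                          ≡⟨ cong (4 *_) 4*card ⟨
      4 * (4 * card C)                                      ≡⟨ *-assoc 4 4 (card C) ⟨
      16 * card C                                           ≡⟨ cong (16 *_) (count-∑ C V) ⟩
      16 * (∑[ w ∈ V ] C w · 1)                             ≡⟨ ∑-shLines i (λ w → C w · 1) ⟨
      ∑[ w ∈ V ] ∑[ a ∈ allZ4² ] C (shUpdate w i a) · 1     ≡⟨ ∑-cong V (λ w → count-∑ (shLine C w i) allZ4²) ⟨
      ∑[ w ∈ V ] cardSh (shLine C w i)                      ∎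
      where open ≡-Reasoning

  kLine-card : ∀ v j → cardK (kLine C v j) ≡ 1
  kLine-card v j = ∑-mono-tight V {λ w → cardK (kLine C w j)} {λ _ → 1}
    (λ w → kCoclique-bound (kLine C w j) (kLine-independent ind w j)) (≤-reflexive total) (∈-allVertices v)
    where
    total : ∑[ w ∈ V ] 1 ≡ ∑[ w ∈ V ] cardK (kLine C w j)
    total = begin
      ∑[ w ∈ V ] 1                                          ≡⟨ ∑-const V 1 ⟩
      length V * 1                                          ≡⟨ *-identityʳ (length V) ⟩
      length V                                              ≡⟨ 4*card ⟨
      4 * card C                                            ≡⟨ cong (4 *_) (count-∑ C V) ⟩
      4 * (∑[ w ∈ V ] C w · 1)                              ≡⟨ ∑-kLines j (λ w → C w · 1) ⟨
      ∑[ w ∈ V ] ∑[ c ∈ allZ2² ] C (kUpdate w j c) · 1      ≡⟨ ∑-cong V (λ w → count-∑ (kLine C w j) allZ2²) ⟨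
      ∑[ w ∈ V ] cardK (kLine C w j)                        ∎
      where open ≡-Reasoning

  outside-nbrs : ∀ v → C v ≡ false → nbrsIn C v ≡ 2 * m + n
  outside-nbrs v Cv = trans (nbrsIn-by-lines C v {2} {1}
    (λ i → shCoclique-nbrs {shLine C v i} (shLine-independent ind v i) (shLine-card v i) (lookup (proj₁ v) i)
                           (trans (shLine-centre C v i) Cv))
    (λ j → kCoclique-nbrs (kLine C v j) (kLine-independent ind v j) (kLine-card v j) (lookup (proj₂ v) j)
                          (trans (kLine-centre C v j) Cv)))
    (cong₂ _+_ (*-comm m 2) (*-identityʳ n))

equitable⇒MDS : ∀ {m n} → 1 ≤ 2 * m + n → (C : VSet m n) →
                IsEquitable C (complement C) 0 (6 * m + 3 * n) (2 * m + n) (4 * m + 2 * n) → IsMDS C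
equitable⇒MDS {m} {n} pos C (inside , outside) = independent , Equivalence.from (MDS-size⇔ m n pos (card C)) size
  where
  V : List (Vertex m n)
  V = allVertices m n

  independent : Independent C
  independent u v Cu Cv =
    nbrsAmong-none⁻ adj V C u (trans (sym (nbrsIn-nbrsAmong C u)) (proj₁ (inside u Cu))) (∈-allVertices v) Cv

  edges-between : card C * (6 * m + 3 * n) ≡ card (complement C) * (2 * m + n)
  edges-between = begin
    card C * (6 * m + 3 * n)
      ≡⟨ ∑-·-count V C _ _ (λ u Cu → trans (sym (nbrsIn-nbrsAmong (complement C) u)) (proj₂ (inside u Cu))) ⟨
    ∑[ u ∈ V ] C u · nbrsAmong adj V (complement C) u
      ≡⟨ double-counting adj adj-sym V C (complement C) ⟩
    ∑[ u ∈ V ] complement C u · nbrsAmong adj V C u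
      ≡⟨ ∑-·-count V (complement C) _ _ (λ u C̄u → trans (sym (nbrsIn-nbrsAmong C u)) (proj₁ (outside u C̄u))) ⟩
    card (complement C) * (2 * m + n) ∎
    where open ≡-Reasoning

  three-times : 3 * card C ≡ card (complement C)
  three-times = *-cancelʳ-≡ _ _ (2 * m + n) {{>-nonZero pos}} (trans (regroup (card C) m n) edges-between)
    where
    regroup : ∀ c m n → 3 * c * (2 * m + n) ≡ c * (6 * m + 3 * n)
    regroup = solve 3 (λ c m n → con 3 :* c :* (con 2 :* m :+ n) := c :* (con 6 :* m :+ con 3 :* n)) refl

  size : 4 * card C ≡ 4 ^ (m + m + n)
  size = trans (cong (card C +_) three-times) (card-complement C)

MDS⇒equitable : ∀ {m n} → 1 ≤ 2 * m + n → (C : VSet m n) →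
                IsMDS C → IsEquitable C (complement C) 0 (6 * m + 3 * n) (2 * m + n) (4 * m + 2 * n)
MDS⇒equitable {m} {n} pos C (ind , size) = inside , outside
  where
  inside : ∀ v → C v ≡ true → nbrsIn C v ≡ 0 × nbrsIn (complement C) v ≡ 6 * m + 3 * n
  inside v Cv = none , nbrsIn-complement C v none refl
    where
    none : nbrsIn C v ≡ 0
    none = trans (nbrsIn-nbrsAmong C v) (nbrsAmong-none adj (allVertices m n) C v (λ u Cu → ind v u Cv Cu))

  outside : ∀ v → complement C v ≡ true → nbrsIn C v ≡ 2 * m + n × nbrsIn (complement C) v ≡ 4 * m + 2 * n
  outside v C̄v = nbrs , nbrsIn-complement C v nbrs (sum m n)
    where
    nbrs : nbrsIn C v ≡ 2 * m + n
    nbrs = LineCounts.outside-nbrs ind (Equivalence.to (MDS-size⇔ m n pos (card C)) size) v (not≡true C̄v)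
    sum : ∀ m n → 2 * m + n + (4 * m + 2 * n) ≡ 6 * m + 3 * n
    sum = solve 2 (λ m n → con 2 :* m :+ n :+ (con 4 :* m :+ con 2 :* n) := con 6 :* m :+ con 3 :* n) refl

IsEquitable-swap : ∀ {m n} {P Q : VSet m n} {a b c d} → IsEquitable P Q a b c d → IsEquitable Q P d c b a
IsEquitable-swap (onP , onQ) = (λ v Qv → swap (onQ v Qv)) , (λ v Pv → swap (onP v Pv))

IsEquitable-cong : ∀ {m n} {P Q Q' : VSet m n} {a b c d} → (∀ v → Q v ≡ Q' v) →
                   IsEquitable P Q a b c d → IsEquitable P Q' a b c d
IsEquitable-cong {m} {n} {P} {Q} {Q'} Q≗Q' (onP , onQ) =
  (λ v Pv → proj₁ (onP v Pv) , trans (sym (Q-count v)) (proj₂ (onP v Pv))) ,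
  (λ v Q'v → let counts = onQ v (trans (Q≗Q' v) Q'v) in proj₁ counts , trans (sym (Q-count v)) (proj₂ counts))
  where
  Q-count : ∀ v → nbrsIn Q v ≡ nbrsIn Q' v
  Q-count v = countL-cong (allVertices m n) {λ u → adj v u ∧ Q u} {λ u → adj v u ∧ Q' u} (λ u → cong (adj v u ∧_) (Q≗Q' u))

complement-equitable⇔MDS : ∀ {m n} → 1 ≤ 2 * m + n → (C : VSet m n) →
  IsEquitable C (complement C) (4 * m + 2 * n) (2 * m + n) (6 * m + 3 * n) 0 ⇔ IsMDS (complement C)
complement-equitable⇔MDS pos C = mk⇔
  (λ eq → equitable⇒MDS pos (complement C) (IsEquitable-cong (λ v → sym (not-involutive (C v))) (IsEquitable-swap eq)))
  (λ mds → IsEquitable-swap (IsEquitable-cong (λ v → not-involutive (C v)) (MDS⇒equitable pos (complement C) mds)))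

-- (b) 2×MDS codes

coclique-nbrs : ∀ {A} → IndependentSh A → cardSh A ≡ 4 → ∀ a → nbrsInSh A a ≡ (if A a then 0 else 2)
coclique-nbrs {A} ind card4 a = by-membership (A a) refl
  where
  by-membership : ∀ s → A a ≡ s → nbrsInSh A a ≡ (if s then 0 else 2)
  by-membership true  Aa = nbrsAmong-none shAdj allZ4² A a (λ b Ab → ind a b Aa Ab)
  by-membership false Aa = shCoclique-nbrs {A} ind card4 a Aa

union-nbrs : ∀ {S} → UnionTwoIndep4 S → ∀ a → nbrsInSh S a ≡ (if S a then 2 else 4)
union-nbrs {S} (_ , A , B , cardA , cardB , indA , indB , disjoint , union) a = begin
  nbrsInSh S a                                     ≡⟨ nbrsAmong-cong shAdj allZ4² {S} {λ b → A b ∨ B b} a union ⟩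
  nbrsInSh (λ b → A b ∨ B b) a                     ≡⟨ nbrsAmong-∨ shAdj allZ4² A B a disjoint ⟩
  nbrsInSh A a + nbrsInSh B a                      ≡⟨ cong₂ _+_ (coclique-nbrs {A} indA cardA a) (coclique-nbrs {B} indB cardB a) ⟩
  (if A a then 0 else 2) + (if B a then 0 else 2)  ≡⟨ count (A a) (B a) (disjoint a) ⟩
  (if A a ∨ B a then 2 else 4)                     ≡⟨ cong (λ s → if s then 2 else 4) (union a) ⟨
  (if S a then 2 else 4)                           ∎
  where
  open ≡-Reasoning
  count : ∀ p q → p ∧ q ≡ false → (if p then 0 else 2) + (if q then 0 else 2) ≡ (if p ∨ q then 2 else 4)
  count true  false _ = refl
  count false true  _ = refl
  count false false _ = refl

2xMDS-nbrs : ∀ {m n} (C : VSet m n) → Is2xMDS C → ∀ v →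
             nbrsIn C v ≡ m * (if C v then 2 else 4) + n * (if C v then 1 else 2)
2xMDS-nbrs C (sh , k) v = nbrsIn-by-lines C v
  (λ i → trans (union-nbrs {shLine C v i} (sh v i) (lookup (proj₁ v) i)) (cong (λ s → if s then 2 else 4) (shLine-centre C v i)))
  (λ j → trans (kHalf-nbrs (kLine C v j) (k v j) (lookup (proj₂ v) j)) (cong (λ s → if s then 1 else 2) (kLine-centre C v j)))

2xMDS⇒equitable : ∀ {m n} (C : VSet m n) → Is2xMDS C →
                  IsEquitable C (complement C) (2 * m + n) (4 * m + 2 * n) (4 * m + 2 * n) (2 * m + n)
2xMDS⇒equitable {m} {n} C 2xMDS = inside , outside
  where
  at : ∀ v {s} → C v ≡ s → nbrsIn C v ≡ m * (if s then 2 else 4) + n * (if s then 1 else 2)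
  at v Cv = trans (2xMDS-nbrs C 2xMDS v) (cong (λ s → m * (if s then 2 else 4) + n * (if s then 1 else 2)) Cv)

  inside : ∀ v → C v ≡ true → nbrsIn C v ≡ 2 * m + n × nbrsIn (complement C) v ≡ 4 * m + 2 * n
  inside v Cv = nbrs , nbrsIn-complement C v nbrs (sum m n)
    where
    nbrs : nbrsIn C v ≡ 2 * m + n
    nbrs = trans (at v Cv) (cong₂ _+_ (*-comm m 2) (*-identityʳ n))
    sum : ∀ m n → 2 * m + n + (4 * m + 2 * n) ≡ 6 * m + 3 * n
    sum = solve 2 (λ m n → con 2 :* m :+ n :+ (con 4 :* m :+ con 2 :* n) := con 6 :* m :+ con 3 :* n) refl

  outside : ∀ v → complement C v ≡ true → nbrsIn C v ≡ 4 * m + 2 * n × nbrsIn (complement C) v ≡ 2 * m + n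
  outside v C̄v = nbrs , nbrsIn-complement C v nbrs (sum m n)
    where
    nbrs : nbrsIn C v ≡ 4 * m + 2 * n
    nbrs = trans (at v (not≡true C̄v)) (cong₂ _+_ (*-comm m 4) (*-comm n 2))
    sum : ∀ m n → 4 * m + 2 * n + (2 * m + n) ≡ 6 * m + 3 * n
    sum = solve 2 (λ m n → con 4 :* m :+ con 2 :* n :+ (con 2 :* m :+ n) := con 6 :* m :+ con 3 :* n) refl

oppositeNbrs : ∀ {m n} → VSet m n → Vertex m n → ℕ
oppositeNbrs C v = nbrsIn (λ u → C v xor C u) v

shOpposite : ∀ {m n} → VSet m n → Vertex m n → Fin m → ℕ
shOpposite C v i = nbrsInSh (λ b → C v xor shLine C v i b) (lookup (proj₁ v) i)

kOpposite : ∀ {m n} → VSet m n → Vertex m n → Fin n → ℕ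
kOpposite C v j = nbrsInK (λ d → C v xor kLine C v j d) (lookup (proj₂ v) j)

oppositeNbrs-lines : ∀ {m n} (C : VSet m n) v →
                     oppositeNbrs C v ≡ (∑[ i ∈ allFin m ] shOpposite C v i) + (∑[ j ∈ allFin n ] kOpposite C v j)
oppositeNbrs-lines {m} {n} C (x , y) = trans (nbrsIn-lines (λ u → C (x , y) xor C u) x y) (cong₂ _+_
  (∑-cong (allFin m) (λ i → nbrsAmong-cong shAdj allZ4² {shLine (λ u → C (x , y) xor C u) (x , y) i}
                                                       {λ b → C (x , y) xor shLine C (x , y) i b} (lookup x i) (λ _ → refl)))
  (∑-cong (allFin n) (λ j → nbrsAmong-cong kAdj allZ2² {kLine (λ u → C (x , y) xor C u) (x , y) j}
                                                      {λ d → C (x , y) xor kLine C (x , y) j d} (lookup y j) (λ _ → refl))))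

shOpposite-shUpdate : ∀ {m n} (C : VSet m n) v i a →
                      shOpposite C (shUpdate v i a) i ≡ nbrsInSh (λ b → shLine C v i a xor shLine C v i b) a
shOpposite-shUpdate C v i a = trans
  (nbrsAmong-cong shAdj allZ4² {λ b → C (shUpdate v i a) xor shLine C (shUpdate v i a) i b}
                               {λ b → shLine C v i a xor shLine C v i b} (lookup (proj₁ (shUpdate v i a)) i)
                               (λ b → cong (shLine C v i a xor_) (shLine-shUpdate C v i a b)))
  (cong (nbrsInSh (λ b → shLine C v i a xor shLine C v i b)) (lookup-shUpdate v i a))

kOpposite-kUpdate : ∀ {m n} (C : VSet m n) v j c →
                    kOpposite C (kUpdate v j c) j ≡ nbrsInK (λ d → kLine C v j c xor kLine C v j d) c
kOpposite-kUpdate C v j c = trans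
  (nbrsAmong-cong kAdj allZ2² {λ d → C (kUpdate v j c) xor kLine C (kUpdate v j c) j d}
                              {λ d → kLine C v j c xor kLine C v j d} (lookup (proj₂ (kUpdate v j c)) j)
                              (λ d → cong (kLine C v j c xor_) (kLine-kUpdate C v j c d)))
  (cong (nbrsInK (λ d → kLine C v j c xor kLine C v j d)) (lookup-kUpdate v j c))

∑-cutSh : ∀ {m n} (C : VSet m n) i →
          ∑[ v ∈ allVertices m n ] cutSh (shLine C v i) ≡ 16 * (∑[ v ∈ allVertices m n ] shOpposite C v i)
∑-cutSh {m} {n} C i = trans
  (∑-cong (allVertices m n) (λ v → ∑-cong allZ4² (λ a → sym (shOpposite-shUpdate C v i a))))
  (∑-shLines i (λ v → shOpposite C v i))

∑-cutK : ∀ {m n} (C : VSet m n) j →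
         ∑[ v ∈ allVertices m n ] cutK (kLine C v j) ≡ 4 * (∑[ v ∈ allVertices m n ] kOpposite C v j)
∑-cutK {m} {n} C j = trans
  (∑-cong (allVertices m n) (λ v → ∑-cong allZ2² (λ c → sym (kOpposite-kUpdate C v j c))))
  (∑-kLines j (λ v → kOpposite C v j))

lineCuts : ∀ {m n} → VSet m n → Vertex m n → ℕ
lineCuts {m} {n} C v = (∑[ i ∈ allFin m ] cutSh (shLine C v i)) + 4 * (∑[ j ∈ allFin n ] cutK (kLine C v j))

∑-lineCuts : ∀ {m n} (C : VSet m n) →
             ∑[ v ∈ allVertices m n ] lineCuts C v ≡ 16 * (∑[ v ∈ allVertices m n ] oppositeNbrs C v)
∑-lineCuts {m} {n} C = begin
  ∑[ v ∈ V ] lineCuts C v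
    ≡⟨ ∑-+ V (λ v → ∑[ i ∈ allFin m ] cutSh (shLine C v i)) (λ v → 4 * (∑[ j ∈ allFin n ] cutK (kLine C v j))) ⟩
  (∑[ v ∈ V ] ∑[ i ∈ allFin m ] cutSh (shLine C v i)) + (∑[ v ∈ V ] 4 * (∑[ j ∈ allFin n ] cutK (kLine C v j)))
    ≡⟨ cong₂ _+_ sh-part k-part ⟩
  16 * (∑[ v ∈ V ] ∑[ i ∈ allFin m ] shOpposite C v i) + 16 * (∑[ v ∈ V ] ∑[ j ∈ allFin n ] kOpposite C v j)
    ≡⟨ *-distribˡ-+ 16 (∑[ v ∈ V ] ∑[ i ∈ allFin m ] shOpposite C v i) (∑[ v ∈ V ] ∑[ j ∈ allFin n ] kOpposite C v j) ⟨
  16 * ((∑[ v ∈ V ] ∑[ i ∈ allFin m ] shOpposite C v i) + (∑[ v ∈ V ] ∑[ j ∈ allFin n ] kOpposite C v j))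
    ≡⟨ cong (16 *_) (trans (∑-cong V (oppositeNbrs-lines C))
                             (∑-+ V (λ v → ∑[ i ∈ allFin m ] shOpposite C v i) (λ v → ∑[ j ∈ allFin n ] kOpposite C v j))) ⟨
  16 * (∑[ v ∈ V ] oppositeNbrs C v) ∎
  where
  open ≡-Reasoning
  V : List (Vertex m n)
  V = allVertices m n

  sh-part : (∑[ v ∈ V ] ∑[ i ∈ allFin m ] cutSh (shLine C v i)) ≡ 16 * (∑[ v ∈ V ] ∑[ i ∈ allFin m ] shOpposite C v i)
  sh-part = begin
    (∑[ v ∈ V ] ∑[ i ∈ allFin m ] cutSh (shLine C v i))         ≡⟨ ∑-swap V (allFin m) _ ⟩
    (∑[ i ∈ allFin m ] ∑[ v ∈ V ] cutSh (shLine C v i))         ≡⟨ ∑-cong (allFin m) (∑-cutSh C) ⟩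
    (∑[ i ∈ allFin m ] 16 * (∑[ v ∈ V ] shOpposite C v i))      ≡⟨ ∑-*ˡ (allFin m) 16 _ ⟩
    16 * (∑[ i ∈ allFin m ] ∑[ v ∈ V ] shOpposite C v i)        ≡⟨ cong (16 *_) (∑-swap (allFin m) V _) ⟩
    16 * (∑[ v ∈ V ] ∑[ i ∈ allFin m ] shOpposite C v i)        ∎

  k-part : (∑[ v ∈ V ] 4 * (∑[ j ∈ allFin n ] cutK (kLine C v j))) ≡ 16 * (∑[ v ∈ V ] ∑[ j ∈ allFin n ] kOpposite C v j)
  k-part = begin
    (∑[ v ∈ V ] 4 * (∑[ j ∈ allFin n ] cutK (kLine C v j)))    ≡⟨ ∑-*ˡ V 4 _ ⟩
    4 * (∑[ v ∈ V ] ∑[ j ∈ allFin n ] cutK (kLine C v j))      ≡⟨ cong (4 *_) (∑-swap V (allFin n) _) ⟩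
    4 * (∑[ j ∈ allFin n ] ∑[ v ∈ V ] cutK (kLine C v j))      ≡⟨ cong (4 *_) (∑-cong (allFin n) (∑-cutK C)) ⟩
    4 * (∑[ j ∈ allFin n ] 4 * (∑[ v ∈ V ] kOpposite C v j))   ≡⟨ cong (4 *_) (∑-*ˡ (allFin n) 4 _) ⟩
    4 * (4 * (∑[ j ∈ allFin n ] ∑[ v ∈ V ] kOpposite C v j))   ≡⟨ *-assoc 4 4 (∑[ j ∈ allFin n ] ∑[ v ∈ V ] kOpposite C v j) ⟨
    16 * (∑[ j ∈ allFin n ] ∑[ v ∈ V ] kOpposite C v j)        ≡⟨ cong (16 *_) (∑-swap (allFin n) V _) ⟩
    16 * (∑[ v ∈ V ] ∑[ j ∈ allFin n ] kOpposite C v j)        ∎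

maxLineCuts : ℕ → ℕ → ℕ
maxLineCuts m n = m * 64 + 4 * (n * 8)

shCuts-bound : ∀ {m n} (C : VSet m n) v → ∑[ i ∈ allFin m ] cutSh (shLine C v i) ≤ m * 64
shCuts-bound {m} C v = ≤-trans (∑-mono (allFin m) (λ i → shCut-bound (shLine C v i))) (≤-reflexive (∑-allFin-const m 64))

kCuts-bound : ∀ {m n} (C : VSet m n) v → ∑[ j ∈ allFin n ] cutK (kLine C v j) ≤ n * 8
kCuts-bound {n = n} C v = ≤-trans (∑-mono (allFin n) (λ j → kCut-bound (kLine C v j))) (≤-reflexive (∑-allFin-const n 8))

lineCuts-bound : ∀ {m n} (C : VSet m n) v → lineCuts C v ≤ maxLineCuts m n
lineCuts-bound C v = +-mono-≤ (shCuts-bound C v) (*-monoʳ-≤ 4 (kCuts-bound C v))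

+-tight : ∀ {a b A B} → a ≤ A → b ≤ B → A + B ≤ a + b → a ≡ A × b ≡ B
+-tight {a} {b} {A} {B} a≤A b≤B tight =
  ≤-antisym a≤A (+-cancelʳ-≤ b A a (≤-trans (+-monoʳ-≤ A b≤B) tight)) ,
  ≤-antisym b≤B (+-cancelˡ-≤ a B b (≤-trans (+-monoˡ-≤ B a≤A) tight))

lineCuts-max : ∀ {m n} (C : VSet m n) v → lineCuts C v ≡ maxLineCuts m n →
               (∀ i → cutSh (shLine C v i) ≡ 64) × (∀ j → cutK (kLine C v j) ≡ 8)
lineCuts-max {m} {n} C v tight =
  (λ i → ∑-mono-tight (allFin m) {λ i → cutSh (shLine C v i)} {λ _ → 64} (λ i → shCut-bound (shLine C v i))
                       (≤-reflexive (trans (∑-allFin-const m 64) (sym sh-sum))) (∈-allFin i)) ,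
  (λ j → ∑-mono-tight (allFin n) {λ j → cutK (kLine C v j)} {λ _ → 8} (λ j → kCut-bound (kLine C v j))
                       (≤-reflexive (trans (∑-allFin-const n 8) (sym k-sum))) (∈-allFin j))
  where
  sums : ∑[ i ∈ allFin m ] cutSh (shLine C v i) ≡ m * 64 × 4 * (∑[ j ∈ allFin n ] cutK (kLine C v j)) ≡ 4 * (n * 8)
  sums = +-tight (shCuts-bound C v) (*-monoʳ-≤ 4 (kCuts-bound C v)) (≤-reflexive (sym tight))
  sh-sum : ∑[ i ∈ allFin m ] cutSh (shLine C v i) ≡ m * 64
  sh-sum = proj₁ sums
  k-sum : ∑[ j ∈ allFin n ] cutK (kLine C v j) ≡ n * 8
  k-sum = *-cancelˡ-≡ _ _ 4 (proj₂ sums)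

equitable⇒2xMDS : ∀ {m n} (C : VSet m n) →
                  IsEquitable C (complement C) (2 * m + n) (4 * m + 2 * n) (4 * m + 2 * n) (2 * m + n) → Is2xMDS C
equitable⇒2xMDS {m} {n} C (inside , outside) =
  (λ v i → shCut-max (shLine C v i) (proj₁ (lineCuts-max C v (tight v)) i)) ,
  (λ v j → kCut-max (kLine C v j) (proj₂ (lineCuts-max C v (tight v)) j))
  where
  V : List (Vertex m n)
  V = allVertices m n

  opposite : ∀ v → oppositeNbrs C v ≡ 4 * m + 2 * n
  opposite v = by-membership (C v) refl
    where
    by-membership : ∀ s → C v ≡ s → oppositeNbrs C v ≡ 4 * m + 2 * n
    by-membership true  Cv = trans (countL-cong V {λ u → adj v u ∧ (C v xor C u)} {λ u → adj v u ∧ not (C u)}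
                                                   (λ u → cong (λ s → adj v u ∧ (s xor C u)) Cv))
                                   (proj₂ (inside v Cv))
    by-membership false Cv = trans (countL-cong V {λ u → adj v u ∧ (C v xor C u)} {λ u → adj v u ∧ C u}
                                                   (λ u → cong (λ s → adj v u ∧ (s xor C u)) Cv))
                                   (proj₁ (outside v (cong not Cv)))

  total : ∑[ v ∈ V ] maxLineCuts m n ≡ ∑[ v ∈ V ] lineCuts C v
  total = begin
    ∑[ v ∈ V ] maxLineCuts m n                 ≡⟨ ∑-cong V (λ _ → regroup m n) ⟩
    ∑[ v ∈ V ] 16 * (4 * m + 2 * n)            ≡⟨ ∑-*ˡ V 16 _ ⟩
    16 * (∑[ v ∈ V ] (4 * m + 2 * n))          ≡⟨ cong (16 *_) (∑-cong V opposite) ⟨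
    16 * (∑[ v ∈ V ] oppositeNbrs C v)         ≡⟨ ∑-lineCuts C ⟨
    ∑[ v ∈ V ] lineCuts C v                    ∎
    where
    open ≡-Reasoning
    regroup : ∀ m n → m * 64 + 4 * (n * 8) ≡ 16 * (4 * m + 2 * n)
    regroup = solve 2 (λ m n → m :* con 64 :+ con 4 :* (n :* con 8) := con 16 :* (con 4 :* m :+ con 2 :* n)) refl

  tight : ∀ v → lineCuts C v ≡ maxLineCuts m n
  tight v = ∑-mono-tight V {lineCuts C} {λ _ → maxLineCuts m n} (lineCuts-bound C) (≤-reflexive total) (∈-allVertices v)

proposition3 : (m n : ℕ) → 1 ≤ 2 * m + n → (C : VSet m n) →
    Nonempty C → Nonempty (complement C) →
    ((IsEquitable C (complement C) 0 (6 * m + 3 * n) (2 * m + n) (4 * m + 2 * n) ⇔ IsMDS C) ×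
     (IsEquitable C (complement C) (4 * m + 2 * n) (2 * m + n) (6 * m + 3 * n) 0 ⇔ IsMDS (complement C))) ×
    (IsEquitable C (complement C) (2 * m + n) (4 * m + 2 * n) (4 * m + 2 * n) (2 * m + n) ⇔ Is2xMDS C)
proposition3 m n pos C _ _ =
  (mk⇔ (equitable⇒MDS pos C) (MDS⇒equitable pos C) , complement-equitable⇔MDS pos C) ,
  mk⇔ (equitable⇒2xMDS C) (2xMDS⇒equitable C)
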